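{- Let $p$ be a prime, $q=p^k$ with $k\ge1$, $\chi$ a primitive Dirichlet character modulo $q$, and $\psi$ a primitive Dirichlet character modulo $q$. Let $m_1,m_2,m_3,r$ be positive integers dividing $q^\infty$ (i.e. powers of $p$) with $(m_1,r)=1$. Define \[ \widehat H(\psi,\chi,m_1,m_2,m_3,r)=\sum_{t,u,v \bmod q}\chi(t+m_2u)\,\overline{\chi}(rt+m_1m_2)\,\overline{\chi}(u)\,\chi(-m_1+ru)\,e\Big(\frac{m_3vt}{q}\Big)\overline{\psi}(v). \] Then $\widehat H(\psi,\chi,m_1,m_2,m_3,r)=0$ unless $(m_1m_2m_3r,q)=1$ (i.e. $m_1=m_2=m_3=r=1$), in which case \[ \widehat H(\psi,\chi,1,1,1,1)=\tau(\overline{\psi})\,g(\chi,\psi),\qquad g(\chi,\psi)=\sum_{t,u \bmod q}\chi(t)\overline{\chi}(t+1)\overline{\chi}(u)\chi(u+1)\psi(ut-1), \] where $\tau(\overline\psi)$ is the Gauss sum of $\overline\psi$. -}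

module Defs where

open import Level using (_⊔_)
open import Algebra.Bundles using (CommutativeRing)
open import Data.Nat as ℕ using (ℕ; zero; suc)
open import Data.Nat.Coprimality using (Coprime)
open import Data.Nat.Divisibility using (_∣_)
open import Data.Integer as ℤ using (ℤ)
import Data.Integer.Divisibility as ℤDiv
open import Data.Product using (_×_; ∃)
open import Data.Sum using (_⊎_)
open import Relation.Nullary using (¬_)
open import Relation.Binary.PropositionalEquality using (_≡_)

DividesPowerOf : ℕ → ℕ → Set
DividesPowerOf m q = ∃ λ j → m ∣ q ℕ.^ j

module _ {c ℓ} (R : CommutativeRing c ℓ) where
  open CommutativeRing R

  natR : ℕ → Carrier
  natR zero    = 0#
  natR (suc n) = 1# + natR n

  pow : Carrier → ℕ → Carrier
  pow x zero    = 1#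
  pow x (suc n) = x * pow x n

  sumR : ℕ → (ℕ → Carrier) → Carrier
  sumR zero    f = 0#
  sumR (suc n) f = sumR n f + f n

  -- R is an integral domain of characteristic 0 (stand-in for ℂ)
  record IsChar0Domain : Set (c ⊔ ℓ) where
    field
      nontrivial : ¬ (1# ≈ 0#)
      noZeroDiv  : ∀ x y → x * y ≈ 0# → (x ≈ 0#) ⊎ (y ≈ 0#)
      char0      : ∀ n → natR n ≈ 0# → n ≡ 0

  -- ζ is a primitive q-th root of unity; e(a/q) := ζ^a
  record IsPrimitiveRoot (q : ℕ) (ζ : Carrier) : Set (c ⊔ ℓ) where
    field
      pow-q   : pow ζ q ≈ 1#
      minimal : ∀ d → 0 ℕ.< d → d ℕ.< q → ¬ (pow ζ d ≈ 1#)

  record IsDirichletCharacter (q : ℕ) (χ : ℤ → Carrier) : Set (c ⊔ ℓ) where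
    field
      periodic  : ∀ n → χ (n ℤ.+ ℤ.+ q) ≈ χ n
      mult      : ∀ m n → χ (m ℤ.* n) ≈ χ m * χ n
      one       : χ (ℤ.+ 1) ≈ 1#
      vanish    : ∀ n → ¬ Coprime ℤ.∣ n ∣ q → χ n ≈ 0#
      nonvanish : ∀ n → Coprime ℤ.∣ n ∣ q → ¬ (χ n ≈ 0#)

  IsInducedModulus : ℕ → (ℤ → Carrier) → ℕ → Set ℓ
  IsInducedModulus q χ d =
    ∀ n → Coprime ℤ.∣ n ∣ q → (ℤ.+ d) ℤDiv.∣ (n ℤ.- ℤ.+ 1) → χ n ≈ 1#

  record IsPrimitiveCharacter (q : ℕ) (χ : ℤ → Carrier) : Set (c ⊔ ℓ) where
    field
      character : IsDirichletCharacter q χ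
      isPrimitive : ∀ d → d ∣ q → IsInducedModulus q χ d → d ≡ q

  -- χ̄ is the complex conjugate of χ: χ̄(n) = χ(n)⁻¹ for (n,q)=1, and 0 otherwise
  IsConjugate : ℕ → (ℤ → Carrier) → (ℤ → Carrier) → Set ℓ
  IsConjugate q χ χ̄ = ∀ n →
    (Coprime ℤ.∣ n ∣ q → χ̄ n * χ n ≈ 1#) × (¬ Coprime ℤ.∣ n ∣ q → χ̄ n ≈ 0#)

  private
    z : ℕ → ℤ
    z = ℤ.+_

  Hhat : (q : ℕ) (ζ : Carrier) (ψ̄ χ χ̄ : ℤ → Carrier) (m₁ m₂ m₃ r : ℕ) → Carrier
  Hhat q ζ ψ̄ χ χ̄ m₁ m₂ m₃ r =
    sumR q λ t → sumR q λ u → sumR q λ v →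
      χ (z t ℤ.+ z m₂ ℤ.* z u)
      * χ̄ (z r ℤ.* z t ℤ.+ z m₁ ℤ.* z m₂)
      * χ̄ (z u)
      * χ (ℤ.- z m₁ ℤ.+ z r ℤ.* z u)
      * pow ζ (m₃ ℕ.* v ℕ.* t)
      * ψ̄ (z v)

  gaussSum : (q : ℕ) (ζ : Carrier) (ψ̄ : ℤ → Carrier) → Carrier
  gaussSum q ζ ψ̄ = sumR q λ v → ψ̄ (z v) * pow ζ v

  gSum : (q : ℕ) (χ χ̄ ψ : ℤ → Carrier) → Carrier
  gSum q χ χ̄ ψ =
    sumR q λ t → sumR q λ u →
      χ (z t) * χ̄ (z t ℤ.+ ℤ.+ 1) * χ̄ (z u) * χ (z u ℤ.+ ℤ.+ 1)
      * ψ (z u ℤ.* z t ℤ.- ℤ.+ 1)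

module Submission where

-- The v-sum in Ĥ is a twisted Gauss sum Σ_v ψ̄(v) e(av/q) = ψ(a) τ(ψ̄) (a unit:
-- substitute v ↦ v a⁻¹; a = p a′: the sum is invariant under v ↦ vn for all units n ≡ 1
-- mod q/p, so it vanishes by primitivity of ψ).  Hence Ĥ = T · τ(ψ̄), where T is the double
-- sum over t, u of B(t,u) = χ(t + m₂u) χ̄(rt + m₁m₂) χ̄(u) χ(-m₁ + ru) ψ(m₃t).
--   * If p ∣ m₃, each ψ(m₃t) = 0.  If p divides r, m₁ or m₂, then for units n ≡ 1 mod q/p
--     (which fix multiples of p modulo q) a rescaling of t (and u) multiplies B by ψ(n);
--     so T = ψ(n) T and T = 0, again by primitivity of ψ.
--   * For m₁ = m₂ = m₃ = r = 1, substitutions u ↦ w⁻¹ + 1 in T and t ↦ (s+1)u⁻¹,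
--     u ↦ w(s+1) in g bring both to the same double sum.

open import Data.Nat as ℕ using (ℕ; zero; suc; _^_; NonZero; _<_)
import Data.Nat.Properties as ℕP
import Data.Nat.Divisibility as ℕD
open import Data.Nat.Coprimality as Coprimality using (Coprime; coprime?; coprime-divisor; coprime-Bézout)
import Data.Nat.GCD as GCD
import Data.Nat.DivMod as DM
open import Data.Nat.Primality using (Prime; prime⇒nonZero; prime⇒nonTrivial; prime⇒irreducible; euclidsLemma)
open import Data.Integer as ℤ using (ℤ; +_; -[1+_]; ∣_∣)
import Data.Integer.Properties as ℤP
import Data.Integer.Divisibility.Signed as S
open import Data.Integer.DivMod using (_%ℕ_; _/ℕ_; a≡a%ℕn+[a/ℕn]*n; n%ℕd<d)
open import Data.Integer.Tactic.RingSolver using (solve-∀)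
open import Data.Product using (Σ; _×_; _,_; proj₁; proj₂)
open import Data.Sum using (_⊎_; inj₁; inj₂; [_,_])
open import Relation.Nullary using (¬_; Dec; yes; no)
open import Relation.Nullary.Negation using (contradiction)
open import Relation.Nullary.Decidable using (map′)
open import Relation.Binary.Bundles using (Setoid)
import Relation.Binary.Reasoning.Setoid as SetoidReasoning
open import Level using (0ℓ)
open import Algebra.Bundles using (CommutativeRing)
import Algebra.Properties.Semiring.Sum as SemiringSum
import Algebra.Properties.Ring as RingProperties
import Algebra.Properties.Group as GroupProperties
import Algebra.Properties.CommutativeSemigroup as CommutativeSemigroupProperties
open import Data.Fin as Fin using (Fin; toℕ)
import Data.Fin.Properties as FinP
open import Data.Fin.Permutation using (permutation)
open import Defs
import Algebra.Solver.CommutativeMonoid as CommutativeMonoidSolver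
open import Data.Vec using ([]; _∷_)
open import Data.Fin.Patterns using (0F; 1F; 2F; 3F; 4F; 5F; 6F; 7F; 8F; 9F)
open import Relation.Binary.PropositionalEquality as P using (_≡_)

bounded-choice : ∀ {a b} {P : ℕ → Set a} {Q : Set b} →
                 (∀ m → P m ⊎ Q) → ∀ N → (∀ m → m < N → P m) ⊎ Q
bounded-choice step zero = inj₁ (λ m ())
bounded-choice step (suc N) with bounded-choice step N | step N
... | inj₂ q | _      = inj₂ q
... | inj₁ _ | inj₂ q = inj₂ q
... | inj₁ below | inj₁ atN = inj₁ λ m m<1+N → [ below m , (λ { P.refl → atN }) ] (ℕP.m<1+n⇒m<n∨m≡n m<1+N)

infix 4 _≡_[mod_]
record _≡_[mod_] (x y : ℤ) (N : ℕ) : Set where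
  constructor mod-divides
  field divides : + N S.∣ x ℤ.- y
open _≡_[mod_] public

module _ {N : ℕ} where

  private
    via : ∀ {a x y} → a ≡ x ℤ.- y → + N S.∣ a → x ≡ y [mod N ]
    via e h = mod-divides (P.subst (+ N S.∣_) e h)

  ≡⇒≡mod : ∀ {x y} → x ≡ y → x ≡ y [mod N ]
  ≡⇒≡mod {x} P.refl = mod-divides (S.divides (+ 0) (ℤP.+-inverseʳ x))

  mod-refl : ∀ {x} → x ≡ x [mod N ]
  mod-refl = ≡⇒≡mod P.refl

  mod-sym : ∀ {x y} → x ≡ y [mod N ] → y ≡ x [mod N ]
  mod-sym {x} {y} h = via (identity x y) (S.∣m⇒∣-m (divides h))
    where
    identity : ∀ x y → ℤ.- (x ℤ.- y) ≡ y ℤ.- x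
    identity = solve-∀

  mod-trans : ∀ {x y z} → x ≡ y [mod N ] → y ≡ z [mod N ] → x ≡ z [mod N ]
  mod-trans {x} {y} {z} h h′ = via (identity x y z) (S.∣m∣n⇒∣m+n (divides h) (divides h′))
    where
    identity : ∀ x y z → (x ℤ.- y) ℤ.+ (y ℤ.- z) ≡ x ℤ.- z
    identity = solve-∀

  +-mod : ∀ {x y u v} → x ≡ y [mod N ] → u ≡ v [mod N ] → x ℤ.+ u ≡ y ℤ.+ v [mod N ]
  +-mod {x} {y} {u} {v} h h′ = via (identity x y u v) (S.∣m∣n⇒∣m+n (divides h) (divides h′))
    where
    identity : ∀ x y u v → (x ℤ.- y) ℤ.+ (u ℤ.- v) ≡ (x ℤ.+ u) ℤ.- (y ℤ.+ v)
    identity = solve-∀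

  *-mod : ∀ {x y u v} → x ≡ y [mod N ] → u ≡ v [mod N ] → x ℤ.* u ≡ y ℤ.* v [mod N ]
  *-mod {x} {y} {u} {v} h h′ =
    via (identity x y u v) (S.∣m∣n⇒∣m+n (S.∣m⇒∣m*n u (divides h)) (S.∣n⇒∣m*n y (divides h′)))
    where
    identity : ∀ x y u v → (x ℤ.- y) ℤ.* u ℤ.+ y ℤ.* (u ℤ.- v) ≡ x ℤ.* u ℤ.- y ℤ.* v
    identity = solve-∀

  +-modˡ : ∀ a {x y} → x ≡ y [mod N ] → a ℤ.+ x ≡ a ℤ.+ y [mod N ]
  +-modˡ a = +-mod (mod-refl {x = a})

  +-modʳ : ∀ a {x y} → x ≡ y [mod N ] → x ℤ.+ a ≡ y ℤ.+ a [mod N ]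
  +-modʳ a h = +-mod h (mod-refl {x = a})

  *-modˡ : ∀ a {x y} → x ≡ y [mod N ] → a ℤ.* x ≡ a ℤ.* y [mod N ]
  *-modˡ a = *-mod (mod-refl {x = a})

  *-modʳ : ∀ a {x y} → x ≡ y [mod N ] → x ℤ.* a ≡ y ℤ.* a [mod N ]
  *-modʳ a h = *-mod h (mod-refl {x = a})

  +-multiple : ∀ x j → x ℤ.+ j ℤ.* + N ≡ x [mod N ]
  +-multiple x j = mod-divides (S.divides j (identity x j (+ N)))
    where
    identity : ∀ x j n → x ℤ.+ j ℤ.* n ℤ.- x ≡ j ℤ.* n
    identity = solve-∀

  mod-divisor : ∀ {M x y} → M ℕD.∣ N → x ≡ y [mod N ] → x ≡ y [mod M ]
  mod-divisor M∣N h = mod-divides (S.∣-trans (S.∣ᵤ⇒∣ M∣N) (divides h))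

infix 4 _≡?_[mod_]
_≡?_[mod_] : ∀ x y N → Dec (x ≡ y [mod N ])
x ≡? y [mod N ] = map′ (λ h → mod-divides (S.∣ᵤ⇒∣ h)) (λ h → S.∣⇒∣ᵤ (divides h)) (N ℕD.∣? ∣ x ℤ.- y ∣)

mod-setoid : ℕ → Setoid 0ℓ 0ℓ
mod-setoid N = record
  { Carrier       = ℤ
  ; _≈_           = _≡_[mod N ]
  ; isEquivalence = record { refl = mod-refl ; sym = mod-sym ; trans = mod-trans }
  }

scale-mod : ∀ {a b x n} → + a S.∣ x → n ≡ + 1 [mod b ] → x ℤ.* n ≡ x [mod a ℕ.* b ]
scale-mod {a} {b} {x} {n} (S.divides i x≡ia) (mod-divides (S.divides j n-1≡jb)) =
  mod-divides (S.divides (i ℤ.* j) (begin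
    x ℤ.* n ℤ.- x                 ≡⟨ factor x n ⟩
    x ℤ.* (n ℤ.- + 1)             ≡⟨ P.cong₂ ℤ._*_ x≡ia n-1≡jb ⟩
    (i ℤ.* + a) ℤ.* (j ℤ.* + b)   ≡⟨ regroup i j (+ a) (+ b) ⟩
    (i ℤ.* j) ℤ.* (+ a ℤ.* + b)   ≡⟨ P.cong ((i ℤ.* j) ℤ.*_) (ℤP.pos-* a b) ⟨
    (i ℤ.* j) ℤ.* + (a ℕ.* b)     ∎))
  where
  open P.≡-Reasoning
  factor : ∀ x n → x ℤ.* n ℤ.- x ≡ x ℤ.* (n ℤ.- + 1)
  factor = solve-∀
  regroup : ∀ i j a b → (i ℤ.* a) ℤ.* (j ℤ.* b) ≡ (i ℤ.* j) ℤ.* (a ℤ.* b)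
  regroup = solve-∀

module Residues (N : ℕ) ⦃ _ : NonZero N ⦄ where

  module ≡mod-Reasoning = SetoidReasoning (mod-setoid N)

  residue-mod : ∀ x → + (x %ℕ N) ≡ x [mod N ]
  residue-mod x =
    mod-sym (P.subst (_≡ + (x %ℕ N) [mod N ]) (P.sym (a≡a%ℕn+[a/ℕn]*n x N)) (+-multiple _ (x /ℕ N)))

  -- Congruent residues r ≥ s below N are equal, since N divides r - s < N.
  private
    ordered : ∀ {r s} → r < N → s ℕ.≤ r → + r ≡ + s [mod N ] → r ≡ s
    ordered {r} {s} r<N s≤r h = ℕP.≤-antisym (ℕP.m∸n≡0⇒m≤n difference≡0) s≤r
      where
      N∣r∸s : N ℕD.∣ r ℕ.∸ s
      N∣r∸s = P.subst (N ℕD.∣_) (P.cong ∣_∣ (P.trans (ℤP.[+m]-[+n]≡m⊖n r s) (ℤP.⊖-≥ s≤r)))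
                      (S.∣⇒∣ᵤ (divides h))
      difference≡0 : r ℕ.∸ s ≡ 0
      difference≡0 = P.trans (P.sym (DM.m<n⇒m%n≡m (ℕP.≤-<-trans (ℕP.m∸n≤m r s) r<N)))
                             (ℕD.n∣m⇒m%n≡0 _ N N∣r∸s)

  residues-equal : ∀ {r s} → r < N → s < N → + r ≡ + s [mod N ] → r ≡ s
  residues-equal {r} {s} r<N s<N h with ℕP.≤-total s r
  ... | inj₁ s≤r = ordered r<N s≤r h
  ... | inj₂ r≤s = P.sym (ordered s<N r≤s (mod-sym h))

  residue-cong : ∀ {x y} → x ≡ y [mod N ] → x %ℕ N ≡ y %ℕ N
  residue-cong {x} {y} h = residues-equal (n%ℕd<d x N) (n%ℕd<d y N)
    (mod-trans (residue-mod x) (mod-trans h (mod-sym (residue-mod y))))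

  record Unit (x : ℤ) : Set where
    constructor unit
    field coprime : Coprime ∣ x ∣ N
  open Unit public

  unit? : ∀ x → Dec (Unit x)
  unit? x with coprime? ∣ x ∣ N
  ... | yes c = yes (unit c)
  ... | no ¬c = no (λ u → ¬c (coprime u))

  unit-1 : Unit (+ 1)
  unit-1 = unit (Coprimality.1-coprimeTo N)

  unit-resp : ∀ {x y} → x ≡ y [mod N ] → Unit x → Unit y
  unit-resp {x} {y} h (unit c) = unit λ {e} (e∣y , e∣N) → c (S.∣⇒∣ᵤ (e∣x e∣y e∣N) , e∣N)
    where
    identity : ∀ x y → (x ℤ.- y) ℤ.+ y ≡ x
    identity = solve-∀
    e∣x : ∀ {e} → e ℕD.∣ ∣ y ∣ → e ℕD.∣ N → + e S.∣ x
    e∣x e∣y e∣N = P.subst (+ _ S.∣_) (identity x y)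
      (S.∣m∣n⇒∣m+n (S.∣-trans (S.∣ᵤ⇒∣ e∣N) (divides h)) (S.∣ᵤ⇒∣ e∣y))

  unit-* : ∀ {x y} → Unit x → Unit y → Unit (x ℤ.* y)
  unit-* {x} {y} (unit cx) (unit cy) = unit λ {e} (e∣xy , e∣N) →
    let e∣∣x∣*∣y∣ = P.subst (e ℕD.∣_) (ℤP.abs-* x y) e∣xy
        coprime-e-x : Coprime e ∣ x ∣
        coprime-e-x (f∣e , f∣x) = cx (f∣x , ℕD.∣-trans f∣e e∣N)
    in cy (coprime-divisor coprime-e-x e∣∣x∣*∣y∣ , e∣N)

  unit-*ˡ : ∀ {x y} → Unit (x ℤ.* y) → Unit x
  unit-*ˡ {x} {y} (unit c) = unit λ (e∣x , e∣N) →
    c (P.subst (_ ℕD.∣_) (P.sym (ℤP.abs-* x y)) (ℕD.∣-trans e∣x (ℕD.m∣m*n ∣ y ∣)) , e∣N)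

  unit-*ʳ : ∀ {x y} → Unit (x ℤ.* y) → Unit y
  unit-*ʳ {x} {y} u = unit-*ˡ (P.subst Unit (ℤP.*-comm x y) u)

  inverse-exists : ∀ {x} → Unit x → Σ ℤ λ y → x ℤ.* y ≡ + 1 [mod N ]
  inverse-exists {+ m} (unit c) with coprime-Bézout c
  ... | GCD.Bézout.+- x y 1+yN≡xm = + x , (begin
    + m ℤ.* + x          ≡⟨ ℤP.pos-* m x ⟨
    + (m ℕ.* x)          ≡⟨ P.cong +_ (P.trans (ℕP.*-comm m x) (P.sym 1+yN≡xm)) ⟩
    + 1 ℤ.+ + (y ℕ.* N)  ≡⟨ P.cong (λ z → + 1 ℤ.+ z) (ℤP.pos-* y N) ⟩
    + 1 ℤ.+ + y ℤ.* + N  ≈⟨ +-multiple (+ 1) (+ y) ⟩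
    + 1                  ∎)
    where open ≡mod-Reasoning
  ... | GCD.Bézout.-+ x y 1+xm≡yN = ℤ.- + x , (begin
    + m ℤ.* ℤ.- + x                 ≡⟨ complement (+ m) (+ x) ⟩
    + 1 ℤ.- (+ 1 ℤ.+ + x ℤ.* + m)   ≡⟨ P.cong (λ z → + 1 ℤ.- (+ 1 ℤ.+ z)) (ℤP.pos-* x m) ⟨
    + 1 ℤ.- + (1 ℕ.+ x ℕ.* m)       ≡⟨ P.cong (λ z → + 1 ℤ.- + z) 1+xm≡yN ⟩
    + 1 ℤ.- + (y ℕ.* N)             ≡⟨ P.cong (λ z → + 1 ℤ.- z) (ℤP.pos-* y N) ⟩
    + 1 ℤ.- + y ℤ.* + N             ≡⟨ negate-multiple (+ 1) (+ y) (+ N) ⟩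
    + 1 ℤ.+ ℤ.- + y ℤ.* + N         ≈⟨ +-multiple (+ 1) (ℤ.- + y) ⟩
    + 1                             ∎)
    where
    open ≡mod-Reasoning
    complement : ∀ m x → m ℤ.* ℤ.- x ≡ + 1 ℤ.- (+ 1 ℤ.+ x ℤ.* m)
    complement = solve-∀
    negate-multiple : ∀ a y n → a ℤ.- y ℤ.* n ≡ a ℤ.+ ℤ.- y ℤ.* n
    negate-multiple = solve-∀
  inverse-exists { -[1+ n ]} (unit c) with inverse-exists {+ suc n} (unit c)
  ... | y , ny≡1 = ℤ.- y , P.subst (_≡ + 1 [mod N ]) (negate-both (+ suc n) y) ny≡1
    where
    negate-both : ∀ a b → a ℤ.* b ≡ ℤ.- a ℤ.* ℤ.- b
    negate-both = solve-∀

  -- A total inverse modulo N, computed from the residue of its argument;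
  -- non-units are sent to (a representative of) themselves.
  private
    invert-residue : ℕ → ℤ
    invert-residue m with unit? (+ m)
    ... | yes u = proj₁ (inverse-exists u)
    ... | no _  = + m

  inv : ℤ → ℤ
  inv x = invert-residue (x %ℕ N)

  inv-cong : ∀ {x y} → x ≡ y [mod N ] → inv x ≡ inv y
  inv-cong h = P.cong invert-residue (residue-cong h)

  inv-unit : ∀ {x} → Unit x → x ℤ.* inv x ≡ + 1 [mod N ]
  inv-unit {x} u = mod-trans (*-modʳ (inv x) (mod-sym (residue-mod x)))
                             (inverse-of-residue (unit-resp (mod-sym (residue-mod x)) u))
    where
    inverse-of-residue : Unit (+ (x %ℕ N)) → + (x %ℕ N) ℤ.* invert-residue (x %ℕ N) ≡ + 1 [mod N ]
    inverse-of-residue u′ with unit? (+ (x %ℕ N))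
    ... | yes u″ = proj₂ (inverse-exists u″)
    ... | no ¬u  = contradiction u′ ¬u

  inv-nonunit : ∀ {x} → ¬ Unit x → inv x ≡ x [mod N ]
  inv-nonunit {x} ¬u with unit? (+ (x %ℕ N))
  ... | yes u = contradiction (unit-resp (residue-mod x) u) ¬u
  ... | no _  = residue-mod x

  inv-Unit : ∀ {x} → Unit x → Unit (inv x)
  inv-Unit {x} u = unit-*ʳ {x} (unit-resp (mod-sym (inv-unit u)) unit-1)

  *-inv-cancel : ∀ {a} → Unit a → ∀ x → x ℤ.* a ℤ.* inv a ≡ x [mod N ]
  *-inv-cancel {a} u x = begin
    x ℤ.* a ℤ.* inv a     ≡⟨ ℤP.*-assoc x a (inv a) ⟩
    x ℤ.* (a ℤ.* inv a)   ≈⟨ *-modˡ x (inv-unit u) ⟩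
    x ℤ.* + 1             ≡⟨ ℤP.*-identityʳ x ⟩
    x                     ∎
    where open ≡mod-Reasoning

  inv-involutive : ∀ x → inv (inv x) ≡ x [mod N ]
  inv-involutive x with unit? x
  ... | no ¬u = P.subst (_≡ x [mod N ]) (P.sym (inv-cong (inv-nonunit ¬u))) (inv-nonunit ¬u)
  ... | yes u = begin
    inv (inv x)                    ≡⟨ ℤP.*-identityˡ (inv (inv x)) ⟨
    + 1 ℤ.* inv (inv x)            ≈⟨ *-modʳ (inv (inv x)) (mod-sym (inv-unit u)) ⟩
    x ℤ.* inv x ℤ.* inv (inv x)    ≈⟨ *-inv-cancel (inv-Unit u) x ⟩
    x                              ∎
    where open ≡mod-Reasoning

module Sums {c ℓ} (R : CommutativeRing c ℓ) where

  open CommutativeRing R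
  open SetoidReasoning setoid
  private module ∑ = SemiringSum semiring

  ∑ : ℕ → (ℕ → Carrier) → Carrier
  ∑ = sumR R

  sum-cong : ∀ n {f g : ℕ → Carrier} → (∀ i → f i ≈ g i) → ∑ n f ≈ ∑ n g
  sum-cong zero    f≈g = refl
  sum-cong (suc n) f≈g = +-cong (sum-cong n f≈g) (f≈g n)

  sum-zero : ∀ n {f : ℕ → Carrier} → (∀ i → f i ≈ 0#) → ∑ n f ≈ 0#
  sum-zero zero    f≈0 = refl
  sum-zero (suc n) f≈0 = trans (+-cong (sum-zero n f≈0) (f≈0 n)) (+-identityˡ 0#)

  sum≈∑ : ∀ n (f : ℕ → Carrier) → ∑ n f ≈ ∑.sum {n} (λ i → f (toℕ i))
  sum≈∑ zero    f = refl
  sum≈∑ (suc n) f = begin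
    ∑ n f + f n                                                 ≈⟨ +-cong (sum≈∑ n f) (reflexive (P.cong f (P.sym (FinP.toℕ-fromℕ n)))) ⟩
    ∑.sum {n} (λ i → f (toℕ i)) + f (toℕ (Fin.fromℕ n))           ≈⟨ +-congʳ (∑.sum-cong-≋ {n} λ i → reflexive (P.cong f (FinP.toℕ-inject₁ i))) ⟨
    ∑.sum {n} (λ i → f (toℕ (Fin.inject₁ i))) + f (toℕ (Fin.fromℕ n)) ≈⟨ ∑.sum-init-last {n} (λ i → f (toℕ i)) ⟨
    ∑.sum {suc n} (λ i → f (toℕ i))                                ∎

  sum-*ˡ : ∀ n x (f : ℕ → Carrier) → x * ∑ n f ≈ ∑ n (λ i → x * f i)
  sum-*ˡ n x f = begin
    x * ∑ n f                           ≈⟨ *-congˡ (sum≈∑ n f) ⟩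
    x * ∑.sum {n} (λ i → f (toℕ i))     ≈⟨ ∑.*-distribˡ-sum {n} x (λ i → f (toℕ i)) ⟩
    ∑.sum {n} (λ i → x * f (toℕ i))     ≈⟨ sum≈∑ n (λ i → x * f i) ⟨
    ∑ n (λ i → x * f i)                 ∎

  sum-*ʳ : ∀ n x (f : ℕ → Carrier) → ∑ n f * x ≈ ∑ n (λ i → f i * x)
  sum-*ʳ n x f = trans (*-comm _ x) (trans (sum-*ˡ n x f) (sum-cong n λ i → *-comm x (f i)))

  sum²-*ˡ : ∀ n m x (f : ℕ → ℕ → Carrier) → x * ∑ n (λ i → ∑ m (f i)) ≈ ∑ n (λ i → ∑ m (λ j → x * f i j))
  sum²-*ˡ n m x f = trans (sum-*ˡ n x _) (sum-cong n λ i → sum-*ˡ m x (f i))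

  sum²-*ʳ : ∀ n m x (f : ℕ → ℕ → Carrier) → ∑ n (λ i → ∑ m (f i)) * x ≈ ∑ n (λ i → ∑ m (λ j → f i j * x))
  sum²-*ʳ n m x f = trans (sum-*ʳ n x _) (sum-cong n λ i → sum-*ʳ m x (f i))

  sum-swap : ∀ n m (f : ℕ → ℕ → Carrier) → ∑ n (λ i → ∑ m (f i)) ≈ ∑ m (λ j → ∑ n (λ i → f i j))
  sum-swap n m f = begin
    ∑ n (λ i → ∑ m (f i))                                   ≈⟨ sum≈∑ n _ ⟩
    ∑.sum {n} (λ i → ∑ m (f (toℕ i)))                       ≈⟨ ∑.sum-cong-≋ {n} (λ i → sum≈∑ m _) ⟩
    ∑.sum {n} (λ i → ∑.sum {m} (λ j → f (toℕ i) (toℕ j)))   ≈⟨ ∑.∑-comm {n} {m} (λ i j → f (toℕ i) (toℕ j)) ⟩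
    ∑.sum {m} (λ j → ∑.sum {n} (λ i → f (toℕ i) (toℕ j)))   ≈⟨ ∑.sum-cong-≋ {m} (λ j → sum≈∑ n _) ⟨
    ∑.sum {m} (λ j → ∑ n (λ i → f i (toℕ j)))               ≈⟨ sum≈∑ m _ ⟨
    ∑ m (λ j → ∑ n (λ i → f i j))                           ∎

  module Reindexing (N : ℕ) ⦃ _ : NonZero N ⦄ where
    open Residues N

    Periodic : (ℤ → Carrier) → Set ℓ
    Periodic F = ∀ {x y} → x ≡ y [mod N ] → F x ≈ F y

    Compatible : (ℤ → ℤ) → Set
    Compatible E = ∀ {x y} → x ≡ y [mod N ] → E x ≡ E y [mod N ]

    sum-bijection : (F : ℤ → Carrier) → Periodic F →
                    (E E′ : ℤ → ℤ) → Compatible E → Compatible E′ →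
                    (∀ x → E′ (E x) ≡ x [mod N ]) → (∀ x → E (E′ x) ≡ x [mod N ]) →
                    ∑ N (λ v → F (E (+ v))) ≈ ∑ N (λ v → F (+ v))
    sum-bijection F F-periodic E E′ E-compatible E′-compatible E′∘E≡id E∘E′≡id = begin
      ∑ N (λ v → F (E (+ v)))                   ≈⟨ sum≈∑ N _ ⟩
      ∑.sum {N} (λ i → F (E (+ toℕ i)))         ≈⟨ ∑.sum-cong-≋ {N} (λ i → F-periodic (mod-sym (residue-of-image E i))) ⟩
      ∑.sum {N} (λ i → F (+ toℕ (induced E i)))  ≈⟨ ∑.sum-permute {N} {N} (λ i → F (+ toℕ i)) π ⟨
      ∑.sum {N} (λ i → F (+ toℕ i))             ≈⟨ sum≈∑ N _ ⟨
      ∑ N (λ v → F (+ v))                       ∎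
      where
      induced : (ℤ → ℤ) → Fin N → Fin N
      induced A i = Fin.fromℕ< (n%ℕd<d (A (+ toℕ i)) N)

      residue-of-image : ∀ A i → + toℕ (induced A i) ≡ A (+ toℕ i) [mod N ]
      residue-of-image A i =
        mod-trans (≡⇒≡mod (P.cong +_ (FinP.toℕ-fromℕ< _))) (residue-mod (A (+ toℕ i)))

      induced-inverse : ∀ A B → Compatible A → (∀ x → A (B x) ≡ x [mod N ]) →
                        ∀ i → induced A (induced B i) ≡ i
      induced-inverse A B A-compatible A∘B≡id i = FinP.toℕ-injective (residues-equal
        (FinP.toℕ<n (induced A (induced B i))) (FinP.toℕ<n i)
        (mod-trans (residue-of-image A (induced B i))
          (mod-trans (A-compatible (residue-of-image B i)) (A∘B≡id (+ toℕ i)))))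

      π = permutation (induced E) (induced E′) (induced-inverse E E′ E-compatible E∘E′≡id)
                                     (induced-inverse E′ E E′-compatible E′∘E≡id)

    sum-*unit : (F : ℤ → Carrier) → Periodic F → ∀ {a} → Unit a →
                ∑ N (λ v → F (+ v ℤ.* a)) ≈ ∑ N (λ v → F (+ v))
    sum-*unit F F-periodic {a} u = sum-bijection F F-periodic (ℤ._* a) (ℤ._* inv a)
      (*-modʳ a) (*-modʳ (inv a)) (*-inv-cancel u) cancel-inverse
      where
      swap : ∀ x a b → x ℤ.* b ℤ.* a ≡ x ℤ.* a ℤ.* b
      swap = solve-∀
      cancel-inverse : ∀ x → x ℤ.* inv a ℤ.* a ≡ x [mod N ]
      cancel-inverse x = P.subst (_≡ x [mod N ]) (P.sym (swap x a (inv a))) (*-inv-cancel u x)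

    sum-shift : (F : ℤ → Carrier) → Periodic F → ∀ b → ∑ N (λ v → F (+ v ℤ.+ b)) ≈ ∑ N (λ v → F (+ v))
    sum-shift F F-periodic b = sum-bijection F F-periodic (ℤ._+ b) (ℤ._- b)
      (+-modʳ b) (+-modʳ (ℤ.- b))
      (λ x → ≡⇒≡mod (shift-back x b)) (λ x → ≡⇒≡mod (shift-forth x b))
      where
      shift-back : ∀ x b → x ℤ.+ b ℤ.- b ≡ x
      shift-back = solve-∀
      shift-forth : ∀ x b → x ℤ.- b ℤ.+ b ≡ x
      shift-forth = solve-∀

    sum-inv : (F : ℤ → Carrier) → Periodic F → ∑ N (λ v → F (inv (+ v))) ≈ ∑ N (λ v → F (+ v))
    sum-inv F F-periodic = sum-bijection F F-periodic inv inv
      (λ h → ≡⇒≡mod (inv-cong h)) (λ h → ≡⇒≡mod (inv-cong h)) inv-involutive inv-involutive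

    Periodic₂ : (ℤ → ℤ → Carrier) → Set ℓ
    Periodic₂ B = ∀ {x x′ y y′} → x ≡ x′ [mod N ] → y ≡ y′ [mod N ] → B x y ≈ B x′ y′

    sum²-*unitˡ : (B : ℤ → ℤ → Carrier) → Periodic₂ B → ∀ {n} → Unit n →
                  ∑ N (λ t → ∑ N (λ u → B (+ t ℤ.* n) (+ u))) ≈ ∑ N (λ t → ∑ N (λ u → B (+ t) (+ u)))
    sum²-*unitˡ B B-periodic = sum-*unit (λ x → ∑ N (λ u → B x (+ u)))
                                         (λ x≡y → sum-cong N (λ u → B-periodic x≡y mod-refl))

    sum²-*unit : (B : ℤ → ℤ → Carrier) → Periodic₂ B → ∀ {n} → Unit n →
                 ∑ N (λ t → ∑ N (λ u → B (+ t ℤ.* n) (+ u ℤ.* n))) ≈ ∑ N (λ t → ∑ N (λ u → B (+ t) (+ u)))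
    sum²-*unit B B-periodic {n} u = begin
      ∑ N (λ t → ∑ N (λ u → B (+ t ℤ.* n) (+ u ℤ.* n)))  ≈⟨ sum²-*unitˡ (λ x y → B x (y ℤ.* n)) (λ x≡ y≡ → B-periodic x≡ (*-modʳ n y≡)) u ⟩
      ∑ N (λ t → ∑ N (λ u → B (+ t) (+ u ℤ.* n)))        ≈⟨ sum-cong N (λ t → sum-*unit (B (+ t)) (B-periodic mod-refl) u) ⟩
      ∑ N (λ t → ∑ N (λ u → B (+ t) (+ u)))              ∎

module _ {c ℓ} (R : CommutativeRing c ℓ) where
  open CommutativeRing R
  open SetoidReasoning setoid
  private module CMS = CommutativeMonoidSolver *-commutativeMonoid

  inverse-unique : ∀ {a a′ b} → a * b ≈ 1# → a′ * b ≈ 1# → a ≈ a′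
  inverse-unique {a} {a′} {b} ab≈1 a′b≈1 = begin
    a               ≈⟨ *-identityʳ a ⟨
    a * 1#          ≈⟨ *-congˡ a′b≈1 ⟨
    a * (a′ * b)    ≈⟨ *-congˡ (*-comm a′ b) ⟩
    a * (b * a′)    ≈⟨ *-assoc a b a′ ⟨
    (a * b) * a′    ≈⟨ *-congʳ ab≈1 ⟩
    1# * a′         ≈⟨ *-identityˡ a′ ⟩
    a′              ∎

  *-vanishesˡ : ∀ {a b} → a ≈ 0# → a * b ≈ 0#
  *-vanishesˡ {b = b} a≈0 = trans (*-congʳ a≈0) (zeroˡ b)

  *-vanishesʳ : ∀ {a b} → b ≈ 0# → a * b ≈ 0#
  *-vanishesʳ {a} b≈0 = trans (*-congˡ b≈0) (zeroʳ a)

  fixed⇒annihilated : ∀ {a S} → S ≈ a * S → (a - 1#) * S ≈ 0#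
  fixed⇒annihilated {a} {S} S≈aS = begin
    (a - 1#) * S          ≈⟨ distribʳ S a (- 1#) ⟩
    a * S + - 1# * S      ≈⟨ +-cong (sym S≈aS) (RingProperties.-1*x≈-x ring S) ⟩
    S - S                 ≈⟨ -‿inverseʳ S ⟩
    0#                    ∎

  pow-+ : ∀ x a b → pow R x (a ℕ.+ b) ≈ pow R x a * pow R x b
  pow-+ x zero    b = sym (*-identityˡ _)
  pow-+ x (suc a) b = trans (*-congˡ (pow-+ x a b)) (sym (*-assoc _ _ _))

  reweigh : ∀ {a b c d e a′ b′ c′ d′ e′ α β γ δ ε w} →
            a′ ≈ α * a → b′ ≈ β * b → c′ ≈ γ * c → d′ ≈ δ * d → e′ ≈ ε * e →
            α * β * γ * δ * ε ≈ w → a′ * b′ * c′ * d′ * e′ ≈ w * (a * b * c * d * e)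
  reweigh {a} {b} {c} {d} {e} {α = α} {β} {γ} {δ} {ε} {w} a′≈ b′≈ c′≈ d′≈ e′≈ weights = begin
    _ * _ * _ * _ * _                                      ≈⟨ *-cong (*-cong (*-cong (*-cong a′≈ b′≈) c′≈) d′≈) e′≈ ⟩
    α * a * (β * b) * (γ * c) * (δ * d) * (ε * e)          ≈⟨ CMS.prove 10 ((((A′ ⊕ B′) ⊕ C′) ⊕ D′) ⊕ E′) (W ⊕ ((((A ⊕ B) ⊕ C) ⊕ D) ⊕ E))
                                                                (α ∷ β ∷ γ ∷ δ ∷ ε ∷ a ∷ b ∷ c ∷ d ∷ e ∷ []) ⟩
    α * β * γ * δ * ε * (a * b * c * d * e)                ≈⟨ *-congʳ weights ⟩
    w * (a * b * c * d * e)                                ∎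
    where
    open CMS using (_⊕_; var)
    A = var 5F ; B = var 6F ; C = var 7F ; D = var 8F ; E = var 9F
    A′ = var 0F ⊕ A ; B′ = var 1F ⊕ B ; C′ = var 2F ⊕ C ; D′ = var 3F ⊕ D ; E′ = var 4F ⊕ E
    W = (((var 0F ⊕ var 1F) ⊕ var 2F) ⊕ var 3F) ⊕ var 4F

  unweighted : ∀ {a a′} → a′ ≈ a → a′ ≈ 1# * a
  unweighted a′≈a = trans a′≈a (sym (*-identityˡ _))

  vanishes₁ : ∀ {a b c d e} → a ≈ 0# → a * b * c * d * e ≈ 0#
  vanishes₁ a≈0 = *-vanishesˡ (*-vanishesˡ (*-vanishesˡ (*-vanishesˡ a≈0)))
  vanishes₂ : ∀ {a b c d e} → b ≈ 0# → a * b * c * d * e ≈ 0#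
  vanishes₂ b≈0 = *-vanishesˡ (*-vanishesˡ (*-vanishesˡ (*-vanishesʳ b≈0)))
  vanishes₃ : ∀ {a b c d e} → c ≈ 0# → a * b * c * d * e ≈ 0#
  vanishes₃ c≈0 = *-vanishesˡ (*-vanishesˡ (*-vanishesʳ c≈0))
  vanishes₄ : ∀ {a b c d e} → d ≈ 0# → a * b * c * d * e ≈ 0#
  vanishes₄ d≈0 = *-vanishesˡ (*-vanishesʳ d≈0)
  vanishes₅ : ∀ {a b c d e} → e ≈ 0# → a * b * c * d * e ≈ 0#
  vanishes₅ = *-vanishesʳ

module Character {c ℓ} (R : CommutativeRing c ℓ) (N : ℕ) ⦃ _ : NonZero N ⦄
                 (χ χ̄ : ℤ → CommutativeRing.Carrier R)
                 (isχ : IsDirichletCharacter R N χ) (conj : IsConjugate R N χ χ̄) where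
  open CommutativeRing R
  open IsDirichletCharacter isχ
  open Residues N
  open Sums R
  open Reindexing N
  open SetoidReasoning setoid
  private module CMS = CommutativeMonoidSolver *-commutativeMonoid

  χ-add-multiple : ∀ m y → χ (y ℤ.+ + m ℤ.* + N) ≈ χ y
  χ-add-multiple zero    y = reflexive (P.cong χ (ℤP.+-identityʳ y))
  χ-add-multiple (suc m) y = begin
    χ (y ℤ.+ + suc m ℤ.* + N)            ≡⟨ P.cong χ (peel y (+ m) (+ N)) ⟩
    χ ((y ℤ.+ + m ℤ.* + N) ℤ.+ + N)      ≈⟨ periodic _ ⟩
    χ (y ℤ.+ + m ℤ.* + N)                ≈⟨ χ-add-multiple m y ⟩
    χ y                                  ∎
    where
    peel : ∀ y m n → y ℤ.+ (+ 1 ℤ.+ m) ℤ.* n ≡ (y ℤ.+ m ℤ.* n) ℤ.+ n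
    peel = solve-∀

  χ-periodic : Periodic χ
  χ-periodic {x} {y} (mod-divides (S.divides (+ m) x-y≡mN)) =
    trans (reflexive (P.cong χ (difference-to-sum x y _ x-y≡mN))) (χ-add-multiple m y)
    where
    difference-to-sum : ∀ x y z → x ℤ.- y ≡ z → x ≡ y ℤ.+ z
    difference-to-sum x y z P.refl = identity x y
      where
      identity : ∀ x y → x ≡ y ℤ.+ (x ℤ.- y)
      identity = solve-∀
  χ-periodic {x} {y} (mod-divides (S.divides -[1+ m ] x-y≡-mN)) =
    sym (trans (reflexive (P.cong χ (negative-difference x y (+ suc m) (+ N) x-y≡-mN))) (χ-add-multiple (suc m) x))
    where
    negative-difference : ∀ x y a n → x ℤ.- y ≡ ℤ.- a ℤ.* n → y ≡ x ℤ.+ a ℤ.* n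
    negative-difference x y a n e =
      P.trans (identity x y) (P.trans (P.cong (λ z → x ℤ.+ ℤ.- z) e) (double-negation x a n))
      where
      identity : ∀ x y → y ≡ x ℤ.+ ℤ.- (x ℤ.- y)
      identity = solve-∀
      double-negation : ∀ x a n → x ℤ.+ ℤ.- (ℤ.- a ℤ.* n) ≡ x ℤ.+ a ℤ.* n
      double-negation = solve-∀

  χ-nonunit : ∀ {x} → ¬ Unit x → χ x ≈ 0#
  χ-nonunit {x} ¬u = vanish x (λ c → ¬u (unit c))

  χ̄-nonunit : ∀ {x} → ¬ Unit x → χ̄ x ≈ 0#
  χ̄-nonunit {x} ¬u = proj₂ (conj x) (λ c → ¬u (unit c))

  χ̄χ≈1 : ∀ {x} → Unit x → χ̄ x * χ x ≈ 1#
  χ̄χ≈1 {x} u = proj₁ (conj x) (coprime u)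

  χχ̄≈1 : ∀ {x} → Unit x → χ x * χ̄ x ≈ 1#
  χχ̄≈1 u = trans (*-comm _ _) (χ̄χ≈1 u)

  χ̄-periodic : Periodic χ̄
  χ̄-periodic {x} {y} x≡y with unit? x
  ... | yes u = inverse-unique R (χ̄χ≈1 u) (trans (*-congˡ (χ-periodic x≡y)) (χ̄χ≈1 (unit-resp x≡y u)))
  ... | no ¬u = trans (χ̄-nonunit ¬u) (sym (χ̄-nonunit (λ u → ¬u (unit-resp (mod-sym x≡y) u))))

  χ̄-mult : ∀ x y → χ̄ (x ℤ.* y) ≈ χ̄ x * χ̄ y
  χ̄-mult x y with unit? x | unit? y
  ... | yes ux | yes uy = inverse-unique R (χ̄χ≈1 (unit-* ux uy)) (begin
    (χ̄ x * χ̄ y) * χ (x ℤ.* y)      ≈⟨ *-congˡ (mult x y) ⟩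
    (χ̄ x * χ̄ y) * (χ x * χ y)      ≈⟨ CMS.prove 4 ((X ⊕ Y) ⊕ (X′ ⊕ Y′)) ((X ⊕ X′) ⊕ (Y ⊕ Y′)) (χ̄ x ∷ χ̄ y ∷ χ x ∷ χ y ∷ []) ⟩
    (χ̄ x * χ x) * (χ̄ y * χ y)      ≈⟨ *-cong (χ̄χ≈1 ux) (χ̄χ≈1 uy) ⟩
    1# * 1#                         ≈⟨ *-identityˡ 1# ⟩
    1#                              ∎)
    where
    open CMS using (_⊕_)
    X = CMS.var 0F ; Y = CMS.var 1F ; X′ = CMS.var 2F ; Y′ = CMS.var 3F
  ... | no ¬ux | _ = trans (χ̄-nonunit (λ u → ¬ux (unit-*ˡ u))) (sym (trans (*-congʳ (χ̄-nonunit ¬ux)) (zeroˡ _)))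
  ... | yes _ | no ¬uy = trans (χ̄-nonunit (λ u → ¬uy (unit-*ʳ {x} u))) (sym (trans (*-congˡ (χ̄-nonunit ¬uy)) (zeroʳ _)))

  χ-scaled : ∀ {a n b} → a ≡ n ℤ.* b [mod N ] → χ a ≈ χ n * χ b
  χ-scaled {a} {n} {b} a≡nb = trans (χ-periodic a≡nb) (mult n b)

  χ̄-scaled : ∀ {a n b} → a ≡ n ℤ.* b [mod N ] → χ̄ a ≈ χ̄ n * χ̄ b
  χ̄-scaled {a} {n} {b} a≡nb = trans (χ̄-periodic a≡nb) (χ̄-mult n b)

  χ-at-inverse : ∀ {x y} → x ℤ.* y ≡ + 1 [mod N ] → χ y ≈ χ̄ x
  χ-at-inverse {x} {y} xy≡1 = inverse-unique R χyχx≈1 (χ̄χ≈1 (unit-*ˡ (unit-resp (mod-sym xy≡1) unit-1)))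
    where
    χyχx≈1 : χ y * χ x ≈ 1#
    χyχx≈1 = trans (*-comm _ _) (trans (sym (mult x y)) (trans (χ-periodic xy≡1) one))

  χ̄-fixed⇒χ-fixed : ∀ {n S} → Unit n → S ≈ χ̄ n * S → S ≈ χ n * S
  χ̄-fixed⇒χ-fixed {n} {S} u S≈χ̄S = sym (begin
    χ n * S             ≈⟨ *-congˡ S≈χ̄S ⟩
    χ n * (χ̄ n * S)     ≈⟨ *-assoc _ _ _ ⟨
    (χ n * χ̄ n) * S     ≈⟨ *-congʳ (χχ̄≈1 u) ⟩
    1# * S              ≈⟨ *-identityˡ S ⟩
    S                   ∎)

  -- A primitive χ annihilates what it fixes: if d is a proper divisor of N and, in a domain,
  -- S = χ(n)·S for all units n ≡ 1 (mod d), then S = 0.  For each residue m, either χ(m) = 1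
  -- or (χ(m) - 1)·S = 0 forces S = 0; if χ(m) = 1 for all such m, then d would be an induced
  -- modulus for χ, contradicting primitivity.
  primitive-annihilates : IsChar0Domain R → IsPrimitiveCharacter R N χ →
                          ∀ {d} → d ℕD.∣ N → ¬ d ≡ N → (S : Carrier) →
                          (∀ n → Unit n → n ≡ + 1 [mod d ] → S ≈ χ n * S) → S ≈ 0#
  primitive-annihilates domain χ-primitive {d} d∣N d≢N S S≈χS =
    conclude (bounded-choice trivial-or-zero N)
    where
    open IsChar0Domain domain
    Trivial : ℕ → Set ℓ
    Trivial m = Unit (+ m) → + m ≡ + 1 [mod d ] → χ (+ m) ≈ 1#

    trivial-or-zero : ∀ m → Trivial m ⊎ S ≈ 0#
    trivial-or-zero m with unit? (+ m) | + m ≡? + 1 [mod d ]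
    ... | no ¬u | _     = inj₁ (λ u _ → contradiction u ¬u)
    ... | yes _ | no ¬c = inj₁ (λ _ c → contradiction c ¬c)
    ... | yes u | yes c with noZeroDiv _ _ (fixed⇒annihilated R (S≈χS (+ m) u c))
    ...   | inj₁ χm-1≈0 = inj₁ (λ _ _ → GroupProperties.x∙y⁻¹≈ε⇒x≈y +-group _ _ χm-1≈0)
    ...   | inj₂ S≈0    = inj₂ S≈0

    induced : (∀ m → m < N → Trivial m) → IsInducedModulus R N χ d
    induced χ≡1-below n coprime d∣n-1 = trans (χ-periodic (mod-sym (residue-mod n)))
      (χ≡1-below (n %ℕ N) (n%ℕd<d n N) (unit-resp (mod-sym (residue-mod n)) (unit coprime))
        (mod-trans (mod-divisor d∣N (residue-mod n)) (mod-divides (S.∣ᵤ⇒∣ d∣n-1))))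

    conclude : (∀ m → m < N → Trivial m) ⊎ S ≈ 0# → S ≈ 0#
    conclude (inj₁ χ≡1-below) = contradiction (isPrimitive d d∣N (induced χ≡1-below)) d≢N
      where open IsPrimitiveCharacter χ-primitive
    conclude (inj₂ S≈0)       = S≈0

-- Arithmetic modulo the prime power q = p^(k′+1); d = p^k′ is its largest proper divisor.
module PrimePower (p k′ : ℕ) (p-prime : Prime p) where

  q d : ℕ
  q = p ^ suc k′
  d = p ^ k′

  instance
    p≢0 : NonZero p
    p≢0 = prime⇒nonZero p-prime
    q≢0 : NonZero q
    q≢0 = ℕP.m^n≢0 p (suc k′)
    d≢0 : NonZero d
    d≢0 = ℕP.m^n≢0 p k′

  d∣q : d ℕD.∣ q
  d∣q = ℕD.n∣m*n p

  d≢q : ¬ d ≡ q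
  d≢q = ℕP.<⇒≢ (P.subst (d <_) (ℕP.*-comm d p)
                  (ℕP.m<m*n d p (ℕ.nonTrivial⇒n>1 p ⦃ prime⇒nonTrivial p-prime ⦄)))

  coprime-to-power : ∀ {m} → ¬ p ℕD.∣ m → ∀ j → Coprime m (p ^ j)
  coprime-to-power {m} p∤m zero = Coprimality.sym (Coprimality.1-coprimeTo m)
  coprime-to-power {m} p∤m (suc j) {e} (e∣m , e∣p^1+j) =
    coprime-to-power p∤m j (e∣m , coprime-divisor coprime-e-p e∣p^1+j)
    where
    coprime-e-p : Coprime e p
    coprime-e-p {f} (f∣e , f∣p) with prime⇒irreducible p-prime f∣p
    ... | inj₁ f≡1 = f≡1
    ... | inj₂ P.refl = contradiction (ℕD.∣-trans f∣e e∣m) p∤m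

  ¬coprime⇒p∣ : ∀ {m} → ¬ Coprime m q → p ℕD.∣ m
  ¬coprime⇒p∣ {m} ¬coprime with p ℕD.∣? m
  ... | yes p∣m = p∣m
  ... | no p∤m  = contradiction (λ {e} → coprime-to-power p∤m (suc k′) {e}) ¬coprime

  open Residues q

  nonunit⇒p∣ : ∀ {x} → ¬ Unit x → + p S.∣ x
  nonunit⇒p∣ ¬u = S.∣ᵤ⇒∣ (¬coprime⇒p∣ (λ c → ¬u (unit c)))

  p∣⇒nonunit : ∀ {x} → + p S.∣ x → ¬ Unit x
  p∣⇒nonunit p∣x (unit c) = ℕ.nonTrivial⇒≢1 ⦃ prime⇒nonTrivial p-prime ⦄ (c (S.∣⇒∣ᵤ p∣x , ℕD.m∣m*n d))

-- The additive character e(x/q) = ζ^x and the twisted Gauss sums of a primitive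
-- character ψ modulo q = p^(k′+1):  Σ_v ψ̄(v) e(av/q) = ψ(a) τ(ψ̄)  for every a.
module GaussSum {c ℓ} (R : CommutativeRing c ℓ) (domain : IsChar0Domain R)
                (p k′ : ℕ) (p-prime : Prime p)
                (ζ : CommutativeRing.Carrier R) (ζ^q≈1 : CommutativeRing._≈_ R (pow R ζ (p ^ suc k′)) (CommutativeRing.1# R))
                (ψ ψ̄ : ℤ → CommutativeRing.Carrier R)
                (ψ-primitive : IsPrimitiveCharacter R (p ^ suc k′) ψ) (ψ-conj : IsConjugate R (p ^ suc k′) ψ ψ̄) where
  open CommutativeRing R
  open PrimePower p k′ p-prime
  open Residues q
  open Sums R
  open Reindexing q
  open Character R q ψ ψ̄ (IsPrimitiveCharacter.character ψ-primitive) ψ-conj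
  open SetoidReasoning setoid
  private module *CS = CommutativeSemigroupProperties *-commutativeSemigroup

  e : ℤ → Carrier
  e x = pow R ζ (x %ℕ q)

  e-periodic : Periodic e
  e-periodic x≡y = reflexive (P.cong (pow R ζ) (residue-cong x≡y))

  pow-ζ≈e : ∀ n → pow R ζ n ≈ e (+ n)
  pow-ζ≈e n = begin
    pow R ζ n                                       ≡⟨ P.cong (pow R ζ) (DM.m≡m%n+[m/n]*n n q) ⟩
    pow R ζ (n ℕ.% q ℕ.+ (n ℕ./ q) ℕ.* q)           ≈⟨ pow-+ R ζ (n ℕ.% q) _ ⟩
    pow R ζ (n ℕ.% q) * pow R ζ ((n ℕ./ q) ℕ.* q)   ≈⟨ *-congˡ (pow-multiple (n ℕ./ q)) ⟩
    pow R ζ (n ℕ.% q) * 1#                          ≈⟨ *-identityʳ _ ⟩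
    e (+ n)                                         ∎
    where
    pow-multiple : ∀ m → pow R ζ (m ℕ.* q) ≈ 1#
    pow-multiple zero    = refl
    pow-multiple (suc m) = trans (pow-+ R ζ q (m ℕ.* q))
      (trans (*-cong ζ^q≈1 (pow-multiple m)) (*-identityˡ 1#))

  gaussSum≈ : gaussSum R q ζ ψ̄ ≈ ∑ q (λ v → ψ̄ (+ v) * e (+ v))
  gaussSum≈ = sum-cong q (λ v → *-congˡ (pow-ζ≈e v))

  -- For a unit a, v ↦ v·a permutes ℤ/q, and ψ̄(v·a) = ψ̄(v) ψ̄(a).
  twisted-gauss-unit : ∀ {a} → Unit a → ∑ q (λ v → ψ̄ (+ v) * e (+ v ℤ.* a)) ≈ ψ a * gaussSum R q ζ ψ̄
  twisted-gauss-unit {a} u = sym (begin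
    ψ a * gaussSum R q ζ ψ̄                                  ≈⟨ *-congˡ gaussSum≈ ⟩
    ψ a * ∑ q (λ v → F (+ v))                               ≈⟨ *-congˡ (sum-*unit F F-periodic u) ⟨
    ψ a * ∑ q (λ v → F (+ v ℤ.* a))                         ≈⟨ sum-*ˡ q (ψ a) _ ⟩
    ∑ q (λ v → ψ a * (ψ̄ (+ v ℤ.* a) * e (+ v ℤ.* a)))       ≈⟨ sum-cong q (λ v → cancel (+ v)) ⟩
    ∑ q (λ v → ψ̄ (+ v) * e (+ v ℤ.* a))                     ∎)
    where
    F : ℤ → Carrier
    F x = ψ̄ x * e x
    F-periodic : Periodic F
    F-periodic x≡y = *-cong (χ̄-periodic x≡y) (e-periodic x≡y)
    cancel : ∀ v → ψ a * (ψ̄ (v ℤ.* a) * e (v ℤ.* a)) ≈ ψ̄ v * e (v ℤ.* a)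
    cancel v = begin
      ψ a * (ψ̄ (v ℤ.* a) * e (v ℤ.* a))      ≈⟨ *-congˡ (*-congʳ (χ̄-mult v a)) ⟩
      ψ a * ((ψ̄ v * ψ̄ a) * e (v ℤ.* a))      ≈⟨ *-congˡ (*CS.xy∙z≈y∙xz _ _ _) ⟩
      ψ a * (ψ̄ a * (ψ̄ v * e (v ℤ.* a)))      ≈⟨ *-assoc _ _ _ ⟨
      (ψ a * ψ̄ a) * (ψ̄ v * e (v ℤ.* a))      ≈⟨ *-congʳ (χχ̄≈1 u) ⟩
      1# * (ψ̄ v * e (v ℤ.* a))               ≈⟨ *-identityˡ _ ⟩
      ψ̄ v * e (v ℤ.* a)                      ∎

  -- Non-units a = p·a′: the sum is invariant under v ↦ v·n for every unit n ≡ 1 (mod d),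
  -- since then v·n·a ≡ v·a (mod q); it picks up the factor ψ̄(n), so it vanishes by primitivity.
  twisted-gauss-nonunit : ∀ {a} → ¬ Unit a → ∑ q (λ v → ψ̄ (+ v) * e (+ v ℤ.* a)) ≈ 0#
  twisted-gauss-nonunit {a} ¬u =
    primitive-annihilates domain ψ-primitive d∣q d≢q S fixed
    where
    S = ∑ q (λ v → ψ̄ (+ v) * e (+ v ℤ.* a))
    F : ℤ → Carrier
    F x = ψ̄ x * e (x ℤ.* a)
    F-periodic : Periodic F
    F-periodic x≡y = *-cong (χ̄-periodic x≡y) (e-periodic (*-modʳ a x≡y))
    fixed : ∀ n → Unit n → n ≡ + 1 [mod d ] → S ≈ ψ n * S
    fixed n un n≡1 = χ̄-fixed⇒χ-fixed un (begin
      S                              ≈⟨ sum-*unit F F-periodic un ⟨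
      ∑ q (λ v → F (+ v ℤ.* n))      ≈⟨ sum-cong q (λ v → rescale (+ v)) ⟩
      ∑ q (λ v → ψ̄ n * F (+ v))      ≈⟨ sum-*ˡ q (ψ̄ n) _ ⟨
      ψ̄ n * S                        ∎)
      where
      rescale : ∀ v → F (v ℤ.* n) ≈ ψ̄ n * F v
      rescale v = begin
        ψ̄ (v ℤ.* n) * e (v ℤ.* n ℤ.* a)    ≈⟨ *-cong (χ̄-mult v n) (e-periodic vna≡va) ⟩
        (ψ̄ v * ψ̄ n) * e (v ℤ.* a)          ≈⟨ *-congʳ (*-comm _ _) ⟩
        (ψ̄ n * ψ̄ v) * e (v ℤ.* a)          ≈⟨ *-assoc _ _ _ ⟩
        ψ̄ n * F v                          ∎
        where
        swap : ∀ v n a → v ℤ.* n ℤ.* a ≡ v ℤ.* a ℤ.* n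
        swap = solve-∀
        vna≡va : v ℤ.* n ℤ.* a ≡ v ℤ.* a [mod q ]
        vna≡va = P.subst (_≡ v ℤ.* a [mod q ]) (P.sym (swap v n a))
                   (scale-mod (S.∣n⇒∣m*n v (nonunit⇒p∣ ¬u)) n≡1)

  twisted-gauss : ∀ a → ∑ q (λ v → ψ̄ (+ v) * e (+ v ℤ.* a)) ≈ ψ a * gaussSum R q ζ ψ̄
  twisted-gauss a with unit? a
  ... | yes u = twisted-gauss-unit u
  ... | no ¬u = trans (twisted-gauss-nonunit ¬u) (sym (trans (*-congʳ (χ-nonunit ¬u)) (zeroˡ _)))

module Lemma6p4 {c ℓ} (R : CommutativeRing c ℓ) (domain : IsChar0Domain R)
                (p k′ : ℕ) (p-prime : Prime p)
                (ζ : CommutativeRing.Carrier R) (ζ^q≈1 : CommutativeRing._≈_ R (pow R ζ (p ^ suc k′)) (CommutativeRing.1# R))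
                (χ χ̄ ψ ψ̄ : ℤ → CommutativeRing.Carrier R)
                (χ-primitive : IsPrimitiveCharacter R (p ^ suc k′) χ) (χ-conj : IsConjugate R (p ^ suc k′) χ χ̄)
                (ψ-primitive : IsPrimitiveCharacter R (p ^ suc k′) ψ) (ψ-conj : IsConjugate R (p ^ suc k′) ψ ψ̄) where
  open CommutativeRing R
  open PrimePower p k′ p-prime
  open Residues q
  open Sums R
  open Reindexing q
  open GaussSum R domain p k′ p-prime ζ ζ^q≈1 ψ ψ̄ ψ-primitive ψ-conj
  module χ = Character R q χ χ̄ (IsPrimitiveCharacter.character χ-primitive) χ-conj
  module ψ = Character R q ψ ψ̄ (IsPrimitiveCharacter.character ψ-primitive) ψ-conj
  open SetoidReasoning setoid
  private
    module CMS = CommutativeMonoidSolver *-commutativeMonoid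
    module *CS = CommutativeSemigroupProperties *-commutativeSemigroup

  -- The summand of Ĥ with the v-sum replaced by ψ(m₃t):
  --   B(t, u) = χ(t + m₂u) χ̄(rt + m₁m₂) χ̄(u) χ(-m₁ + ru) ψ(m₃t),
  -- and its sum T over t, u mod q.
  B : (m₁ m₂ m₃ r : ℕ) → ℤ → ℤ → Carrier
  B m₁ m₂ m₃ r t u = χ (t ℤ.+ + m₂ ℤ.* u) * χ̄ (+ r ℤ.* t ℤ.+ + m₁ ℤ.* + m₂) * χ̄ u
                       * χ (ℤ.- + m₁ ℤ.+ + r ℤ.* u) * ψ (+ m₃ ℤ.* t)

  T : (m₁ m₂ m₃ r : ℕ) → Carrier
  T m₁ m₂ m₃ r = ∑ q λ t → ∑ q λ u → B m₁ m₂ m₃ r (+ t) (+ u)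

  B-periodic : ∀ m₁ m₂ m₃ r → Periodic₂ (B m₁ m₂ m₃ r)
  B-periodic m₁ m₂ m₃ r t≡ u≡ =
    *-cong (*-cong (*-cong (*-cong (χ.χ-periodic (+-mod t≡ (*-modˡ (+ m₂) u≡)))
                                   (χ.χ̄-periodic (+-modʳ (+ m₁ ℤ.* + m₂) (*-modˡ (+ r) t≡))))
                           (χ.χ̄-periodic u≡))
                   (χ.χ-periodic (+-modˡ (ℤ.- + m₁) (*-modˡ (+ r) u≡))))
           (ψ.χ-periodic (*-modˡ (+ m₃) t≡))

  -- The v-sum in Ĥ is the twisted Gauss sum Σ_v ψ̄(v) e(v·m₃t/q) = ψ(m₃t) τ(ψ̄), so Ĥ = T·τ(ψ̄).
  Ĥ-factorises : ∀ m₁ m₂ m₃ r → Hhat R q ζ ψ̄ χ χ̄ m₁ m₂ m₃ r ≈ T m₁ m₂ m₃ r * gaussSum R q ζ ψ̄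
  Ĥ-factorises m₁ m₂ m₃ r = begin
    Hhat R q ζ ψ̄ χ χ̄ m₁ m₂ m₃ r                                  ≈⟨ sum-cong q (λ t → sum-cong q (λ u → v-sum t u)) ⟩
    ∑ q (λ t → ∑ q (λ u → B m₁ m₂ m₃ r (+ t) (+ u) * τ))          ≈⟨ sum²-*ʳ q q τ _ ⟨
    T m₁ m₂ m₃ r * τ                                             ∎
    where
    τ = gaussSum R q ζ ψ̄
    v-sum : ∀ t u → ∑ q (λ v → χ (+ t ℤ.+ + m₂ ℤ.* + u) * χ̄ (+ r ℤ.* + t ℤ.+ + m₁ ℤ.* + m₂) * χ̄ (+ u)
                                * χ (ℤ.- + m₁ ℤ.+ + r ℤ.* + u) * pow R ζ (m₃ ℕ.* v ℕ.* t) * ψ̄ (+ v))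
                    ≈ B m₁ m₂ m₃ r (+ t) (+ u) * τ
    v-sum t u = begin
      ∑ q (λ v → k * pow R ζ (m₃ ℕ.* v ℕ.* t) * ψ̄ (+ v))             ≈⟨ sum-cong q (λ v → term v) ⟩
      ∑ q (λ v → k * (ψ̄ (+ v) * e (+ v ℤ.* (+ m₃ ℤ.* + t))))         ≈⟨ sum-*ˡ q k _ ⟨
      k * ∑ q (λ v → ψ̄ (+ v) * e (+ v ℤ.* (+ m₃ ℤ.* + t)))           ≈⟨ *-congˡ (twisted-gauss (+ m₃ ℤ.* + t)) ⟩
      k * (ψ (+ m₃ ℤ.* + t) * τ)                                     ≈⟨ *-assoc _ _ _ ⟨
      B m₁ m₂ m₃ r (+ t) (+ u) * τ                                   ∎
      where
      k = χ (+ t ℤ.+ + m₂ ℤ.* + u) * χ̄ (+ r ℤ.* + t ℤ.+ + m₁ ℤ.* + m₂) * χ̄ (+ u) * χ (ℤ.- + m₁ ℤ.+ + r ℤ.* + u)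
      reorder : ∀ a b c → a ℤ.* (b ℤ.* c) ≡ b ℤ.* (a ℤ.* c)
      reorder = solve-∀
      exponent : ∀ v → + (m₃ ℕ.* v ℕ.* t) ≡ + v ℤ.* (+ m₃ ℤ.* + t)
      exponent v = P.trans (ℤP.pos-* (m₃ ℕ.* v) t)
                     (P.trans (P.cong (ℤ._* + t) (ℤP.pos-* m₃ v)) (P.trans (ℤP.*-assoc (+ m₃) (+ v) (+ t)) (reorder (+ m₃) (+ v) (+ t))))
      term : ∀ v → k * pow R ζ (m₃ ℕ.* v ℕ.* t) * ψ̄ (+ v) ≈ k * (ψ̄ (+ v) * e (+ v ℤ.* (+ m₃ ℤ.* + t)))
      term v = begin
        k * pow R ζ (m₃ ℕ.* v ℕ.* t) * ψ̄ (+ v)           ≈⟨ *-congʳ (*-congˡ (pow-ζ≈e _)) ⟩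
        k * e (+ (m₃ ℕ.* v ℕ.* t)) * ψ̄ (+ v)             ≡⟨ P.cong (λ x → k * e x * ψ̄ (+ v)) (exponent v) ⟩
        k * e (+ v ℤ.* (+ m₃ ℤ.* + t)) * ψ̄ (+ v)         ≈⟨ *CS.xy∙z≈x∙zy _ _ _ ⟩
        k * (ψ̄ (+ v) * e (+ v ℤ.* (+ m₃ ℤ.* + t)))       ∎

  -- Multiplication by n fixes multiples of p modulo q,
  -- so when p divides r, m₁ or m₂ the substitution t ↦ tn (and u ↦ un unless p ∣ m₂)
  -- multiplies each summand of T by ψ(n).
  module Rescaling (m₁ m₂ m₃ r : ℕ) {n : ℤ} (n-unit : Unit n) (n≡1 : n ≡ + 1 [mod d ]) where

    absorbʳ : ∀ x {c} → + p S.∣ c → x ℤ.* n ℤ.+ c ≡ n ℤ.* (x ℤ.+ c) [mod q ]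
    absorbʳ x {c} p∣c = mod-trans (+-modˡ (x ℤ.* n) (mod-sym (scale-mod p∣c n≡1))) (≡⇒≡mod (factor x c n))
      where
      factor : ∀ x c n → x ℤ.* n ℤ.+ c ℤ.* n ≡ n ℤ.* (x ℤ.+ c)
      factor = solve-∀

    absorbˡ : ∀ x {c} → + p S.∣ c → c ℤ.+ x ℤ.* n ≡ n ℤ.* (c ℤ.+ x) [mod q ]
    absorbˡ x {c} p∣c = P.subst₂ _≡_[mod q ] (ℤP.+-comm (x ℤ.* n) c) (P.cong (n ℤ.*_) (ℤP.+-comm x c)) (absorbʳ x p∣c)

    fixes : ∀ {a} x → + p S.∣ a → a ℤ.* (x ℤ.* n) ≡ a ℤ.* x [mod q ]
    fixes {a} x p∣a = P.subst (_≡ a ℤ.* x [mod q ]) (ℤP.*-assoc a x n) (scale-mod (S.∣m⇒∣m*n x p∣a) n≡1)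

    reassoc : ∀ a x → a ℤ.* (x ℤ.* n) ≡ a ℤ.* x ℤ.* n [mod q ]
    reassoc a x = ≡⇒≡mod (P.sym (ℤP.*-assoc a x n))

    first-factor : ∀ t u → χ (t ℤ.* n ℤ.+ + m₂ ℤ.* (u ℤ.* n)) ≈ χ n * χ (t ℤ.+ + m₂ ℤ.* u)
    first-factor t u = χ.χ-scaled (≡⇒≡mod (factor t (+ m₂) u n))
      where
      factor : ∀ t m u n → t ℤ.* n ℤ.+ m ℤ.* (u ℤ.* n) ≡ n ℤ.* (t ℤ.+ m ℤ.* u)
      factor = solve-∀

    last-factor : ∀ t → ψ (+ m₃ ℤ.* (t ℤ.* n)) ≈ ψ n * ψ (+ m₃ ℤ.* t)
    last-factor t = ψ.χ-scaled (≡⇒≡mod (factor (+ m₃) t n))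
      where
      factor : ∀ m t n → m ℤ.* (t ℤ.* n) ≡ n ℤ.* (m ℤ.* t)
      factor = solve-∀

    χ̄u-factor : ∀ u → χ̄ (u ℤ.* n) ≈ χ̄ n * χ̄ u
    χ̄u-factor u = χ.χ̄-scaled (≡⇒≡mod (ℤP.*-comm u n))

    χχ̄ : χ n * χ̄ n ≈ 1#
    χχ̄ = χ.χχ̄≈1 n-unit

    weights-r : χ n * 1# * χ̄ n * 1# * ψ n ≈ ψ n
    weights-r = begin
      χ n * 1# * χ̄ n * 1# * ψ n   ≈⟨ CMS.prove 3 ((((X ⊕ id) ⊕ X̄) ⊕ id) ⊕ Y) ((X ⊕ X̄) ⊕ Y) (χ n ∷ χ̄ n ∷ ψ n ∷ []) ⟩
      (χ n * χ̄ n) * ψ n           ≈⟨ *-congʳ χχ̄ ⟩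
      1# * ψ n                    ≈⟨ *-identityˡ (ψ n) ⟩
      ψ n                         ∎
      where
      open CMS using (_⊕_; var; id)
      X = var 0F ; X̄ = var 1F ; Y = var 2F

    weights-m₁ : χ n * χ̄ n * χ̄ n * χ n * ψ n ≈ ψ n
    weights-m₁ = begin
      χ n * χ̄ n * χ̄ n * χ n * ψ n     ≈⟨ CMS.prove 3 ((((X ⊕ X̄) ⊕ X̄) ⊕ X) ⊕ Y) ((X ⊕ X̄) ⊕ ((X ⊕ X̄) ⊕ Y)) (χ n ∷ χ̄ n ∷ ψ n ∷ []) ⟩
      (χ n * χ̄ n) * ((χ n * χ̄ n) * ψ n)  ≈⟨ *-cong χχ̄ (*-congʳ χχ̄) ⟩
      1# * (1# * ψ n)                  ≈⟨ trans (*-identityˡ _) (*-identityˡ (ψ n)) ⟩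
      ψ n                              ∎
      where
      open CMS using (_⊕_; var)
      X = var 0F ; X̄ = var 1F ; Y = var 2F

    weights-m₂ : χ n * χ̄ n * 1# * 1# * ψ n ≈ ψ n
    weights-m₂ = begin
      χ n * χ̄ n * 1# * 1# * ψ n   ≈⟨ CMS.prove 3 ((((X ⊕ X̄) ⊕ id) ⊕ id) ⊕ Y) ((X ⊕ X̄) ⊕ Y) (χ n ∷ χ̄ n ∷ ψ n ∷ []) ⟩
      (χ n * χ̄ n) * ψ n           ≈⟨ *-congʳ χχ̄ ⟩
      1# * ψ n                    ≈⟨ *-identityˡ (ψ n) ⟩
      ψ n                         ∎
      where
      open CMS using (_⊕_; var; id)
      X = var 0F ; X̄ = var 1F ; Y = var 2F

    -- p ∣ r: both arguments of χ̄(rt + m₁m₂) and χ(-m₁ + ru) are unchanged.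
    rescale-r : + p S.∣ + r → ∀ t u → B m₁ m₂ m₃ r (t ℤ.* n) (u ℤ.* n) ≈ ψ n * B m₁ m₂ m₃ r t u
    rescale-r p∣r t u = reweigh R
      (first-factor t u)
      (unweighted R (χ.χ̄-periodic (+-modʳ (+ m₁ ℤ.* + m₂) (fixes t p∣r))))
      (χ̄u-factor u)
      (unweighted R (χ.χ-periodic (+-modˡ (ℤ.- + m₁) (fixes u p∣r))))
      (last-factor t)
      weights-r

    -- p ∣ m₁: rt + m₁m₂ and -m₁ + ru are both multiplied by n.
    rescale-m₁ : + p S.∣ + m₁ → ∀ t u → B m₁ m₂ m₃ r (t ℤ.* n) (u ℤ.* n) ≈ ψ n * B m₁ m₂ m₃ r t u
    rescale-m₁ p∣m₁ t u = reweigh R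
      (first-factor t u)
      (χ.χ̄-scaled (mod-trans (+-modʳ (+ m₁ ℤ.* + m₂) (reassoc (+ r) t))
                             (absorbʳ (+ r ℤ.* t) (S.∣m⇒∣m*n (+ m₂) p∣m₁))))
      (χ̄u-factor u)
      (χ.χ-scaled (mod-trans (+-modˡ (ℤ.- + m₁) (reassoc (+ r) u))
                             (absorbˡ (+ r ℤ.* u) (S.∣m⇒∣-m p∣m₁))))
      (last-factor t)
      weights-m₁

    -- p ∣ m₂: only t is rescaled; t + m₂u and rt + m₁m₂ are multiplied by n.
    rescale-m₂ : + p S.∣ + m₂ → ∀ t u → B m₁ m₂ m₃ r (t ℤ.* n) u ≈ ψ n * B m₁ m₂ m₃ r t u
    rescale-m₂ p∣m₂ t u = reweigh R
      (χ.χ-scaled (absorbʳ t (S.∣m⇒∣m*n u p∣m₂)))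
      (χ.χ̄-scaled (mod-trans (+-modʳ (+ m₁ ℤ.* + m₂) (reassoc (+ r) t))
                             (absorbʳ (+ r ℤ.* t) (S.∣n⇒∣m*n (+ m₁) p∣m₂))))
      (unweighted R refl)
      (unweighted R refl)
      (last-factor t)
      weights-m₂

  -- If a rescaling multiplies every summand by ψ(n), then T = ψ(n)·T for all units
  -- n ≡ 1 (mod d), and T = 0 by primitivity of ψ.
  module _ (m₁ m₂ m₃ r : ℕ) where
    private
      T-annihilated : (∀ n → Unit n → n ≡ + 1 [mod d ] → T m₁ m₂ m₃ r ≈ ψ n * T m₁ m₂ m₃ r) → T m₁ m₂ m₃ r ≈ 0#
      T-annihilated = ψ.primitive-annihilates domain ψ-primitive d∣q d≢q (T m₁ m₂ m₃ r)

      ψ-out : ∀ n → ∑ q (λ t → ∑ q (λ u → ψ n * B m₁ m₂ m₃ r (+ t) (+ u))) ≈ ψ n * T m₁ m₂ m₃ r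
      ψ-out n = sym (sum²-*ˡ q q (ψ n) _)

    T-vanishes-rescaling-both :
      (∀ {n} → Unit n → n ≡ + 1 [mod d ] → ∀ t u → B m₁ m₂ m₃ r (t ℤ.* n) (u ℤ.* n) ≈ ψ n * B m₁ m₂ m₃ r t u) →
      T m₁ m₂ m₃ r ≈ 0#
    T-vanishes-rescaling-both rescale = T-annihilated λ n n-unit n≡1 → begin
      T m₁ m₂ m₃ r                                                     ≈⟨ sum²-*unit (B m₁ m₂ m₃ r) (B-periodic m₁ m₂ m₃ r) n-unit ⟨
      ∑ q (λ t → ∑ q (λ u → B m₁ m₂ m₃ r (+ t ℤ.* n) (+ u ℤ.* n)))     ≈⟨ sum-cong q (λ t → sum-cong q (λ u → rescale n-unit n≡1 (+ t) (+ u))) ⟩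
      ∑ q (λ t → ∑ q (λ u → ψ n * B m₁ m₂ m₃ r (+ t) (+ u)))           ≈⟨ ψ-out n ⟩
      ψ n * T m₁ m₂ m₃ r                                               ∎

    T-vanishes-rescaling-first :
      (∀ {n} → Unit n → n ≡ + 1 [mod d ] → ∀ t u → B m₁ m₂ m₃ r (t ℤ.* n) u ≈ ψ n * B m₁ m₂ m₃ r t u) →
      T m₁ m₂ m₃ r ≈ 0#
    T-vanishes-rescaling-first rescale = T-annihilated λ n n-unit n≡1 → begin
      T m₁ m₂ m₃ r                                                     ≈⟨ sum²-*unitˡ (B m₁ m₂ m₃ r) (B-periodic m₁ m₂ m₃ r) n-unit ⟨
      ∑ q (λ t → ∑ q (λ u → B m₁ m₂ m₃ r (+ t ℤ.* n) (+ u)))           ≈⟨ sum-cong q (λ t → sum-cong q (λ u → rescale n-unit n≡1 (+ t) (+ u))) ⟩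
      ∑ q (λ t → ∑ q (λ u → ψ n * B m₁ m₂ m₃ r (+ t) (+ u)))           ≈⟨ ψ-out n ⟩
      ψ n * T m₁ m₂ m₃ r                                               ∎

    -- p ∣ m₃: every summand contains ψ(m₃t) = 0.
    T-vanishes-m₃ : + p S.∣ + m₃ → T m₁ m₂ m₃ r ≈ 0#
    T-vanishes-m₃ p∣m₃ = sum-zero q λ t → sum-zero q λ u →
      vanishes₅ R (ψ.χ-nonunit (p∣⇒nonunit (S.∣m⇒∣m*n (+ t) p∣m₃)))

    T-vanishes : p ℕD.∣ m₁ ℕ.* m₂ ℕ.* m₃ ℕ.* r → T m₁ m₂ m₃ r ≈ 0#
    T-vanishes p∣m₁m₂m₃r with euclidsLemma (m₁ ℕ.* m₂ ℕ.* m₃) r p-prime p∣m₁m₂m₃r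
    ... | inj₂ p∣r = T-vanishes-rescaling-both λ u n≡1 → Rescaling.rescale-r m₁ m₂ m₃ r u n≡1 (S.∣ᵤ⇒∣ p∣r)
    ... | inj₁ p∣m₁m₂m₃ with euclidsLemma (m₁ ℕ.* m₂) m₃ p-prime p∣m₁m₂m₃
    ...   | inj₂ p∣m₃ = T-vanishes-m₃ (S.∣ᵤ⇒∣ p∣m₃)
    ...   | inj₁ p∣m₁m₂ with euclidsLemma m₁ m₂ p-prime p∣m₁m₂
    ...     | inj₁ p∣m₁ = T-vanishes-rescaling-both λ u n≡1 → Rescaling.rescale-m₁ m₁ m₂ m₃ r u n≡1 (S.∣ᵤ⇒∣ p∣m₁)
    ...     | inj₂ p∣m₂ = T-vanishes-rescaling-first λ u n≡1 → Rescaling.rescale-m₂ m₁ m₂ m₃ r u n≡1 (S.∣ᵤ⇒∣ p∣m₂)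

  -- Both are transformed into the double sum of
  --   G(s, w) = χ(sw + w + 1) χ̄(s + 1) χ̄(w + 1) χ̄(w) ψ(s):
  -- T by u ↦ w⁻¹ + 1, and g by t ↦ (s + 1)u⁻¹ followed by u ↦ w(s + 1).
  G : ℤ → ℤ → Carrier
  G s w = χ (s ℤ.* w ℤ.+ w ℤ.+ + 1) * χ̄ (s ℤ.+ + 1) * χ̄ (w ℤ.+ + 1) * χ̄ w * ψ s

  private
    cancel-shift : ∀ x → ℤ.- + 1 ℤ.+ + 1 ℤ.* (x ℤ.+ + 1) ≡ x
    cancel-shift = solve-∀

  -- Under u = w⁻¹ + 1 the summand B(t, u) of T(1,1,1,1) becomes G(t, w).
  -- (For a non-unit w both vanish: the fourth factors are χ(w⁻¹) = χ(w) = 0 and χ̄(w) = 0.)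
  T-summand-at-inverse : ∀ t w → B 1 1 1 1 t (inv w ℤ.+ + 1) ≈ G t w
  T-summand-at-inverse t w with unit? w
  ... | no ¬u = trans (vanishes₄ R (trans (χ.χ-periodic (mod-trans (≡⇒≡mod (cancel-shift (inv w))) (inv-nonunit ¬u)))
                                          (χ.χ-nonunit ¬u)))
                      (sym (vanishes₄ R (χ.χ̄-nonunit ¬u)))
  ... | yes u = trans (reweigh R first (unweighted R (reflexive (P.cong χ̄ (simplify₂ t))))
                               third (unweighted R fourth) (unweighted R (reflexive (P.cong ψ (ℤP.*-identityˡ t))))
                               weights)
                      (*-identityˡ _)
    where
    w′ = inv w
    ww′≡1 : w ℤ.* w′ ≡ + 1 [mod q ]
    ww′≡1 = inv-unit u
    expand₁ : ∀ t w w′ → w′ ℤ.* (t ℤ.* w ℤ.+ w ℤ.+ + 1) ≡ (w ℤ.* w′) ℤ.* t ℤ.+ w ℤ.* w′ ℤ.+ w′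
    expand₁ = solve-∀
    collect₁ : ∀ t w′ → + 1 ℤ.* t ℤ.+ + 1 ℤ.+ w′ ≡ t ℤ.+ + 1 ℤ.* (w′ ℤ.+ + 1)
    collect₁ = solve-∀
    first : χ (t ℤ.+ + 1 ℤ.* (w′ ℤ.+ + 1)) ≈ χ w′ * χ (t ℤ.* w ℤ.+ w ℤ.+ + 1)
    first = χ.χ-scaled (mod-sym (mod-trans (≡⇒≡mod (expand₁ t w w′))
              (mod-trans (+-modʳ w′ (+-mod (*-modʳ t ww′≡1) ww′≡1)) (≡⇒≡mod (collect₁ t w′)))))
    simplify₂ : ∀ t → + 1 ℤ.* t ℤ.+ + 1 ℤ.* + 1 ≡ t ℤ.+ + 1
    simplify₂ = solve-∀
    expand₃ : ∀ w w′ → w′ ℤ.* (w ℤ.+ + 1) ≡ w ℤ.* w′ ℤ.+ w′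
    expand₃ = solve-∀
    commute₃ : ∀ w′ → + 1 ℤ.+ w′ ≡ w′ ℤ.+ + 1
    commute₃ = solve-∀
    third : χ̄ (w′ ℤ.+ + 1) ≈ χ̄ w′ * χ̄ (w ℤ.+ + 1)
    third = χ.χ̄-scaled (mod-sym (mod-trans (≡⇒≡mod (expand₃ w w′))
              (mod-trans (+-modʳ w′ ww′≡1) (≡⇒≡mod (commute₃ w′)))))
    fourth : χ (ℤ.- + 1 ℤ.+ + 1 ℤ.* (w′ ℤ.+ + 1)) ≈ χ̄ w
    fourth = trans (reflexive (P.cong χ (cancel-shift w′))) (χ.χ-at-inverse ww′≡1)
    weights : χ w′ * 1# * χ̄ w′ * 1# * 1# ≈ 1#
    weights = begin
      χ w′ * 1# * χ̄ w′ * 1# * 1#   ≈⟨ CMS.prove 2 ((((X ⊕ id) ⊕ X̄) ⊕ id) ⊕ id) (X ⊕ X̄) (χ w′ ∷ χ̄ w′ ∷ []) ⟩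
      χ w′ * χ̄ w′                  ≈⟨ χ.χχ̄≈1 (inv-Unit u) ⟩
      1#                           ∎
      where
      open CMS using (_⊕_; var; id)
      X = var 0F ; X̄ = var 1F

  T≈ΣG : T 1 1 1 1 ≈ ∑ q (λ t → ∑ q (λ w → G (+ t) (+ w)))
  T≈ΣG = sum-cong q λ t → begin
    ∑ q (λ u → B 1 1 1 1 (+ t) (+ u))                  ≈⟨ sum-shift (B 1 1 1 1 (+ t)) (B-periodic 1 1 1 1 mod-refl) (+ 1) ⟨
    ∑ q (λ u → B 1 1 1 1 (+ t) (+ u ℤ.+ + 1))          ≈⟨ sum-inv (λ x → B 1 1 1 1 (+ t) (x ℤ.+ + 1))
                                                                (λ x≡y → B-periodic 1 1 1 1 mod-refl (+-modʳ (+ 1) x≡y)) ⟨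
    ∑ q (λ w → B 1 1 1 1 (+ t) (inv (+ w) ℤ.+ + 1))    ≈⟨ sum-cong q (λ w → T-summand-at-inverse (+ t) (+ w)) ⟩
    ∑ q (λ w → G (+ t) (+ w))                          ∎

  -- The summand of g(χ,ψ), and the intermediate summand obtained after t ↦ (s + 1)u⁻¹.
  g-summand : ℤ → ℤ → Carrier
  g-summand t u = χ t * χ̄ (t ℤ.+ + 1) * χ̄ u * χ (u ℤ.+ + 1) * ψ (u ℤ.* t ℤ.- + 1)

  H : ℤ → ℤ → Carrier
  H s u = χ (s ℤ.+ + 1) * χ̄ (s ℤ.+ + 1 ℤ.+ u) * χ̄ u * χ (u ℤ.+ + 1) * ψ s

  g-summand-at : ∀ {u} → Unit u → ∀ s → g-summand ((s ℤ.+ + 1) ℤ.* inv u) u ≈ H s u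
  g-summand-at {u} u-unit s = trans (reweigh R first second (unweighted R refl) (unweighted R refl) fifth weights)
                                    (*-identityˡ _)
    where
    u′ = inv u
    uu′≡1 : u ℤ.* u′ ≡ + 1 [mod q ]
    uu′≡1 = inv-unit u-unit
    first : χ ((s ℤ.+ + 1) ℤ.* u′) ≈ χ u′ * χ (s ℤ.+ + 1)
    first = χ.χ-scaled (≡⇒≡mod (ℤP.*-comm (s ℤ.+ + 1) u′))
    expand₂ : ∀ s u u′ → u′ ℤ.* (s ℤ.+ + 1 ℤ.+ u) ≡ (s ℤ.+ + 1) ℤ.* u′ ℤ.+ u ℤ.* u′
    expand₂ = solve-∀
    second : χ̄ ((s ℤ.+ + 1) ℤ.* u′ ℤ.+ + 1) ≈ χ̄ u′ * χ̄ (s ℤ.+ + 1 ℤ.+ u)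
    second = χ.χ̄-scaled (mod-sym (mod-trans (≡⇒≡mod (expand₂ s u u′)) (+-modˡ ((s ℤ.+ + 1) ℤ.* u′) uu′≡1)))
    expand₅ : ∀ s u u′ → u ℤ.* ((s ℤ.+ + 1) ℤ.* u′) ℤ.- + 1 ≡ (u ℤ.* u′) ℤ.* (s ℤ.+ + 1) ℤ.- + 1
    expand₅ = solve-∀
    simplify₅ : ∀ s → + 1 ℤ.* (s ℤ.+ + 1) ℤ.- + 1 ≡ s
    simplify₅ = solve-∀
    fifth : ψ (u ℤ.* ((s ℤ.+ + 1) ℤ.* u′) ℤ.- + 1) ≈ 1# * ψ s
    fifth = unweighted R (ψ.χ-periodic (mod-trans (≡⇒≡mod (expand₅ s u u′))
              (mod-trans (+-modʳ (ℤ.- + 1) (*-modʳ (s ℤ.+ + 1) uu′≡1)) (≡⇒≡mod (simplify₅ s)))))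
    weights : χ u′ * χ̄ u′ * 1# * 1# * 1# ≈ 1#
    weights = begin
      χ u′ * χ̄ u′ * 1# * 1# * 1#   ≈⟨ CMS.prove 2 ((((X ⊕ X̄) ⊕ id) ⊕ id) ⊕ id) (X ⊕ X̄) (χ u′ ∷ χ̄ u′ ∷ []) ⟩
      χ u′ * χ̄ u′                  ≈⟨ χ.χχ̄≈1 (inv-Unit u-unit) ⟩
      1#                           ∎
      where
      open CMS using (_⊕_; var; id)
      X = var 0F ; X̄ = var 1F

  H-at : ∀ {s} → Unit (s ℤ.+ + 1) → ∀ w → H s (w ℤ.* (s ℤ.+ + 1)) ≈ G s w
  H-at {s} s+1-unit w = begin
    χ (s ℤ.+ + 1) * χ̄ (s ℤ.+ + 1 ℤ.+ w ℤ.* (s ℤ.+ + 1)) * χ̄ (w ℤ.* (s ℤ.+ + 1)) * χ (w ℤ.* (s ℤ.+ + 1) ℤ.+ + 1) * ψ s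
      ≈⟨ *-congʳ (*-cong (*-cong (*-congˡ (trans (reflexive (P.cong χ̄ (factor s w))) (χ.χ̄-mult _ _))) (χ.χ̄-mult _ _))
                         (reflexive (P.cong χ (expand s w)))) ⟩
    N * (C * N̄) * (D * N̄) * A * ψ s
      ≈⟨ CMS.prove 6 ((((N′ ⊕ (C′ ⊕ N̄′)) ⊕ (D′ ⊕ N̄′)) ⊕ A′) ⊕ E′) ((N′ ⊕ N̄′) ⊕ ((((A′ ⊕ N̄′) ⊕ C′) ⊕ D′) ⊕ E′))
                     (N ∷ N̄ ∷ A ∷ C ∷ D ∷ ψ s ∷ []) ⟩
    (N * N̄) * (A * N̄ * C * D * ψ s)  ≈⟨ *-congʳ (χ.χχ̄≈1 s+1-unit) ⟩
    1# * G s w                       ≈⟨ *-identityˡ _ ⟩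
    G s w                            ∎
    where
    N = χ (s ℤ.+ + 1) ; N̄ = χ̄ (s ℤ.+ + 1)
    A = χ (s ℤ.* w ℤ.+ w ℤ.+ + 1) ; C = χ̄ (w ℤ.+ + 1) ; D = χ̄ w
    factor : ∀ s w → s ℤ.+ + 1 ℤ.+ w ℤ.* (s ℤ.+ + 1) ≡ (w ℤ.+ + 1) ℤ.* (s ℤ.+ + 1)
    factor = solve-∀
    expand : ∀ s w → w ℤ.* (s ℤ.+ + 1) ℤ.+ + 1 ≡ s ℤ.* w ℤ.+ w ℤ.+ + 1
    expand = solve-∀
    open CMS using (_⊕_; var)
    N′ = var 0F ; N̄′ = var 1F ; A′ = var 2F ; C′ = var 3F ; D′ = var 4F ; E′ = var 5F

  g≈ΣG : gSum R q χ χ̄ ψ ≈ ∑ q (λ s → ∑ q (λ w → G (+ s) (+ w)))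
  g≈ΣG = begin
    gSum R q χ χ̄ ψ                                   ≈⟨ sum-swap q q (λ t u → g-summand (+ t) (+ u)) ⟩
    ∑ q (λ u → ∑ q (λ t → g-summand (+ t) (+ u)))    ≈⟨ sum-cong q substitute-t ⟩
    ∑ q (λ u → ∑ q (λ s → H (+ s) (+ u)))            ≈⟨ sum-swap q q (λ u s → H (+ s) (+ u)) ⟩
    ∑ q (λ s → ∑ q (λ u → H (+ s) (+ u)))            ≈⟨ sum-cong q substitute-u ⟩
    ∑ q (λ s → ∑ q (λ w → G (+ s) (+ w)))            ∎
    where
    -- t ↦ (s + 1)·u⁻¹ for a unit u; for a non-unit u both sides vanish because of χ̄(u).
    substitute-t : ∀ u → ∑ q (λ t → g-summand (+ t) (+ u)) ≈ ∑ q (λ s → H (+ s) (+ u))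
    substitute-t u with unit? (+ u)
    ... | no ¬u = trans (sum-zero q (λ _ → vanishes₃ R (χ.χ̄-nonunit ¬u))) (sym (sum-zero q (λ _ → vanishes₃ R (χ.χ̄-nonunit ¬u))))
    ... | yes u-unit = begin
      ∑ q (λ t → g-summand (+ t) (+ u))                            ≈⟨ sum-*unit F F-periodic (inv-Unit u-unit) ⟨
      ∑ q (λ t → F (+ t ℤ.* inv (+ u)))                            ≈⟨ sum-shift (λ x → F (x ℤ.* inv (+ u))) (λ x≡y → F-periodic (*-modʳ _ x≡y)) (+ 1) ⟨
      ∑ q (λ s → g-summand ((+ s ℤ.+ + 1) ℤ.* inv (+ u)) (+ u))    ≈⟨ sum-cong q (λ s → g-summand-at u-unit (+ s)) ⟩
      ∑ q (λ s → H (+ s) (+ u))                                    ∎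
      where
      F : ℤ → Carrier
      F t = g-summand t (+ u)
      F-periodic : Periodic F
      F-periodic t≡ = *-cong (*-congʳ (*-congʳ (*-cong (χ.χ-periodic t≡) (χ.χ̄-periodic (+-modʳ (+ 1) t≡)))))
                             (ψ.χ-periodic (+-modʳ (ℤ.- + 1) (*-modˡ (+ u) t≡)))

    -- u ↦ w·(s + 1) for a unit s + 1; otherwise both sides vanish because of χ(s + 1), χ̄(s + 1).
    substitute-u : ∀ s → ∑ q (λ u → H (+ s) (+ u)) ≈ ∑ q (λ w → G (+ s) (+ w))
    substitute-u s with unit? (+ s ℤ.+ + 1)
    ... | no ¬u = trans (sum-zero q (λ _ → vanishes₁ R (χ.χ-nonunit ¬u))) (sym (sum-zero q (λ _ → vanishes₂ R (χ.χ̄-nonunit ¬u))))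
    ... | yes s+1-unit = begin
      ∑ q (λ u → H (+ s) (+ u))                           ≈⟨ sum-*unit (H (+ s)) H-periodic s+1-unit ⟨
      ∑ q (λ w → H (+ s) (+ w ℤ.* (+ s ℤ.+ + 1)))         ≈⟨ sum-cong q (λ w → H-at s+1-unit (+ w)) ⟩
      ∑ q (λ w → G (+ s) (+ w))                           ∎
      where
      H-periodic : Periodic (H (+ s))
      H-periodic u≡ = *-congʳ (*-cong (*-cong (*-congˡ (χ.χ̄-periodic (+-modˡ (+ s ℤ.+ + 1) u≡))) (χ.χ̄-periodic u≡))
                                      (χ.χ-periodic (+-modʳ (+ 1) u≡)))

  Ĥ-at-one : Hhat R q ζ ψ̄ χ χ̄ 1 1 1 1 ≈ gaussSum R q ζ ψ̄ * gSum R q χ χ̄ ψ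
  Ĥ-at-one = begin
    Hhat R q ζ ψ̄ χ χ̄ 1 1 1 1              ≈⟨ Ĥ-factorises 1 1 1 1 ⟩
    T 1 1 1 1 * gaussSum R q ζ ψ̄          ≈⟨ *-congʳ (trans T≈ΣG (sym g≈ΣG)) ⟩
    gSum R q χ χ̄ ψ * gaussSum R q ζ ψ̄     ≈⟨ *-comm _ _ ⟩
    gaussSum R q ζ ψ̄ * gSum R q χ χ̄ ψ     ∎

  Ĥ-vanishes : ∀ m₁ m₂ m₃ r → ¬ Coprime (m₁ ℕ.* m₂ ℕ.* m₃ ℕ.* r) q → Hhat R q ζ ψ̄ χ χ̄ m₁ m₂ m₃ r ≈ 0#
  Ĥ-vanishes m₁ m₂ m₃ r ¬coprime =
    trans (Ĥ-factorises m₁ m₂ m₃ r) (*-vanishesˡ R (T-vanishes m₁ m₂ m₃ r (¬coprime⇒p∣ ¬coprime)))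

open import Data.Nat using (_*_; _≤_)

-- Lemma 6.4.
lemma6p4 : ∀ {c ℓ} (R : CommutativeRing c ℓ) → IsChar0Domain R →
  (p k : ℕ) → Prime p → 1 ≤ k →
  (ζ : CommutativeRing.Carrier R) → IsPrimitiveRoot R (p ^ k) ζ →
  (χ χ̄ ψ ψ̄ : ℤ → CommutativeRing.Carrier R) →
  IsPrimitiveCharacter R (p ^ k) χ → IsConjugate R (p ^ k) χ χ̄ →
  IsPrimitiveCharacter R (p ^ k) ψ → IsConjugate R (p ^ k) ψ ψ̄ →
  ((m₁ m₂ m₃ r : ℕ) →
     DividesPowerOf m₁ (p ^ k) → DividesPowerOf m₂ (p ^ k) →
     DividesPowerOf m₃ (p ^ k) → DividesPowerOf r (p ^ k) →
     Coprime m₁ r → ¬ Coprime (m₁ * m₂ * m₃ * r) (p ^ k) →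
     CommutativeRing._≈_ R (Hhat R (p ^ k) ζ ψ̄ χ χ̄ m₁ m₂ m₃ r) (CommutativeRing.0# R))
  ×
  CommutativeRing._≈_ R (Hhat R (p ^ k) ζ ψ̄ χ χ̄ 1 1 1 1)
    (CommutativeRing._*_ R (gaussSum R (p ^ k) ζ ψ̄) (gSum R (p ^ k) χ χ̄ ψ))
lemma6p4 R domain p zero     p-prime ()
lemma6p4 R domain p (suc k′) p-prime _ ζ ζ-root χ χ̄ ψ ψ̄ χ-primitive χ-conj ψ-primitive ψ-conj =
  (λ m₁ m₂ m₃ r _ _ _ _ _ → Ĥ-vanishes m₁ m₂ m₃ r) , Ĥ-at-one
  where open Lemma6p4 R domain p k′ p-prime ζ (IsPrimitiveRoot.pow-q ζ-root) χ χ̄ ψ ψ̄ χ-primitive χ-conj ψ-primitive ψ-conj
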